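{- Let $n\ge1$ and let $\{S_0,S_-,S_+,S_F\}$ be a partition of $S_{n,n}=[n]\times[n]$. There exists an alternating sign matrix which is $0$ on the positions in $S_0$, non-negative on the positions in $S_+$, and non-positive on the positions in $S_-$ if and only if $|\mathcal I|\ge n$ holds for every separated family $\mathcal I$ of segments which covers the positions in $S_F$ exactly once, the positions in $S_+$ at least once, and the positions in $S_-$ at most once.
   Context: An alternating sign matrix (ASM) is a $(0,\pm1)$-valued $n\times n$ matrix whose row and column sums are all $1$ and whose nonzero entries alternate in sign in each row and column. Horizontal (vertical) segments are sets of consecutive positions in a row (column). A separated system of horizontal segments is a set of pairwise disjoint horizontal segments each of which is a maximal horizontal segment of their union; analogously for vertical. A separated family of segments is $\mathcal I=\mathcal I^1\uplus\mathcal I^2$ with $\mathcal I^1$ a separated system of horizontal segments and $\mathcal I^2$ a separated system of vertical segments, taken with multiplicity (a one-element segment in both counts twice); $|\mathcal I|=|\mathcal I^1|+|\mathcal I^2|$, and a position is covered as many times as the number of members of $\mathcal I$ containing it. -}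

module Defs where

open import Data.Nat as ℕ using (ℕ; zero; suc)
open import Data.Fin as Fin using (Fin; zero; suc)
open import Data.Integer as ℤ using (ℤ; 0ℤ; 1ℤ; -1ℤ; -_)
open import Data.Product using (_×_; _,_; Σ; ∃)
open import Data.Sum using (_⊎_)
open import Data.List using (List; []; _∷_; length)
open import Data.List.Relation.Unary.All using (All)
open import Data.List.Relation.Unary.Any using (Any)
open import Data.List.Relation.Unary.AllPairs using (AllPairs)
open import Relation.Nullary using (¬_; Dec; yes; no)
open import Relation.Nullary.Decidable using (_×-dec_)
open import Relation.Binary.PropositionalEquality using (_≡_; _≢_)

Matrix : ℕ → Set
Matrix n = Fin n → Fin n → ℤ

sumℤ : ∀ {n} → (Fin n → ℤ) → ℤ
sumℤ {zero}  f = 0ℤ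
sumℤ {suc n} f = f zero ℤ.+ sumℤ (λ i → f (suc i))

IsSignEntry : ℤ → Set
IsSignEntry x = x ≡ 0ℤ ⊎ x ≡ 1ℤ ⊎ x ≡ -1ℤ

Alternates : ∀ {n} → (Fin n → ℤ) → Set
Alternates {n} v = ∀ (j k : Fin n) → j Fin.< k → v j ≢ 0ℤ → v k ≢ 0ℤ →
  (∀ (l : Fin n) → j Fin.< l → l Fin.< k → v l ≡ 0ℤ) →
  v k ≡ - v j

record IsASM {n : ℕ} (A : Matrix n) : Set where
  field
    entries  : ∀ i j → IsSignEntry (A i j)
    rowSum   : ∀ i → sumℤ (λ j → A i j) ≡ 1ℤ
    colSum   : ∀ j → sumℤ (λ i → A i j) ≡ 1ℤ
    rowAlt   : ∀ i → Alternates (λ j → A i j)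
    colAlt   : ∀ j → Alternates (λ i → A i j)

Pos : ℕ → Set
Pos n = Fin n × Fin n     -- (row , column)

-- A partition {S0, S-, S+, SF} of [n]×[n] is given by labelling
-- every position with the block it belongs to.
data Block : Set where
  S0 S- S+ SF : Block

Partition : ℕ → Set
Partition n = Pos n → Block

record HSeg (n : ℕ) : Set where
  constructor hseg
  field
    row    : Fin n
    lo hi  : Fin n
    lo≤hi  : lo Fin.≤ hi

record VSeg (n : ℕ) : Set where
  constructor vseg
  field
    col    : Fin n
    lo hi  : Fin n
    lo≤hi  : lo Fin.≤ hi

_∈H_ : ∀ {n} → Pos n → HSeg n → Set
(i , j) ∈H s = i ≡ HSeg.row s × HSeg.lo s Fin.≤ j × j Fin.≤ HSeg.hi s

_∈V_ : ∀ {n} → Pos n → VSeg n → Set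
(i , j) ∈V s = j ≡ VSeg.col s × VSeg.lo s Fin.≤ i × i Fin.≤ VSeg.hi s

_∈H?_ : ∀ {n} (p : Pos n) (s : HSeg n) → Dec (p ∈H s)
(i , j) ∈H? s = (i Fin.≟ HSeg.row s) ×-dec ((HSeg.lo s Fin.≤? j) ×-dec (j Fin.≤? HSeg.hi s))

_∈V?_ : ∀ {n} (p : Pos n) (s : VSeg n) → Dec (p ∈V s)
(i , j) ∈V? s = (j Fin.≟ VSeg.col s) ×-dec ((VSeg.lo s Fin.≤? i) ×-dec (i Fin.≤? VSeg.hi s))

UnionH : ∀ {n} → List (HSeg n) → Pos n → Set
UnionH ss p = Any (λ s → p ∈H s) ss

UnionV : ∀ {n} → List (VSeg n) → Pos n → Set
UnionV ss p = Any (λ s → p ∈V s) ss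

DisjointH : ∀ {n} → HSeg n → HSeg n → Set
DisjointH s t = ∀ p → ¬ (p ∈H s × p ∈H t)

DisjointV : ∀ {n} → VSeg n → VSeg n → Set
DisjointV s t = ∀ p → ¬ (p ∈V s × p ∈V t)

MaximalH : ∀ {n} → HSeg n → (Pos n → Set) → Set
MaximalH {n} s U = (∀ p → p ∈H s → U p) ×
  (∀ (t : HSeg n) → (∀ p → p ∈H s → p ∈H t) → (∀ p → p ∈H t → U p) →
     ∀ p → p ∈H t → p ∈H s)

MaximalV : ∀ {n} → VSeg n → (Pos n → Set) → Set
MaximalV {n} s U = (∀ p → p ∈V s → U p) ×
  (∀ (t : VSeg n) → (∀ p → p ∈V s → p ∈V t) → (∀ p → p ∈V t → U p) →
     ∀ p → p ∈V t → p ∈V s)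

SeparatedH : ∀ {n} → List (HSeg n) → Set
SeparatedH ss = AllPairs DisjointH ss × All (λ s → MaximalH s (UnionH ss)) ss

SeparatedV : ∀ {n} → List (VSeg n) → Set
SeparatedV ss = AllPairs DisjointV ss × All (λ s → MaximalV s (UnionV ss)) ss

record Family (n : ℕ) : Set where
  constructor family
  field
    hor : List (HSeg n)
    ver : List (VSeg n)

SeparatedFamily : ∀ {n} → Family n → Set
SeparatedFamily I = SeparatedH (Family.hor I) × SeparatedV (Family.ver I)

size : ∀ {n} → Family n → ℕ
size I = length (Family.hor I) ℕ.+ length (Family.ver I)

countH : ∀ {n} → Pos n → List (HSeg n) → ℕ
countH p [] = 0
countH p (s ∷ ss) with p ∈H? s
... | yes _ = suc (countH p ss)
... | no  _ = countH p ss

countV : ∀ {n} → Pos n → List (VSeg n) → ℕ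
countV p [] = 0
countV p (s ∷ ss) with p ∈V? s
... | yes _ = suc (countV p ss)
... | no  _ = countV p ss

cover : ∀ {n} → Family n → Pos n → ℕ
cover I p = countH p (Family.hor I) ℕ.+ countV p (Family.ver I)

Respects : ∀ {n} → Partition n → Matrix n → Set
Respects {n} P A = ∀ (p : Pos n) → Cond (P p) (A (Data.Product.proj₁ p) (Data.Product.proj₂ p))
  where
    Cond : Block → ℤ → Set
    Cond S0 x = x ≡ 0ℤ
    Cond S+ x = 0ℤ ℤ.≤ x
    Cond S- x = x ℤ.≤ 0ℤ
    Cond SF x = Data.Unit.⊤
      where import Data.Unit

AdmissibleCover : ∀ {n} → Partition n → Family n → Set
AdmissibleCover {n} P I = ∀ (p : Pos n) → Cond (P p) (cover I p)
  where
    Cond : Block → ℕ → Set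
    Cond S0 k = Data.Unit.⊤
      where import Data.Unit
    Cond S+ k = 1 ℕ.≤ k
    Cond S- k = k ℕ.≤ 1
    Cond SF k = k ≡ 1

-- Necessity: an ASM A sums to n, and on every position A ≤ A · (times covered) by the block
-- conditions; summing segment by segment, each segment contributes at most 1 because the nonzero
-- entries along a row or column alternate in sign. So n ≤ |I|.
--
-- Sufficiency: an ASM respecting the partition is an integral flow of value n in a grid network
-- with a horizontal and a vertical node per cell. One unit enters every row from the source, runs
-- rightwards, turns downwards (the matrix entry is the net amount turning in a cell, restricted by
-- its block) and leaves every column into the sink. Augmenting along simple paths either reaches
-- value n, or stops at a flow of value k < n together with a set V of nodes closed under residual
-- arcs. The maximal runs of horizontal nodes outside V and of vertical nodes inside V then form a
-- separated family covering every position as the partition demands, and its size is the flow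
-- value k, contradicting the hypothesis.

module Submission where

open import Defs
open import Data.Nat as ℕ using (ℕ; zero; suc; z≤n; s≤s; s≤s⁻¹; _≡ᵇ_; _≤_; _<_)
import Data.Nat.Properties as ℕP
open import Data.Fin as Fin using (Fin; zero; suc; toℕ; fromℕ<)
import Data.Fin.Properties as FinP
open import Data.Integer as ℤ using (ℤ; 0ℤ; 1ℤ; -1ℤ; -_; +_; _+_; _-_; _*_)
import Data.Integer.Properties as ℤP
open import Data.Integer.Tactic.RingSolver using (solve-∀)
open import Data.Bool using (Bool; true; false; _∧_; not; T; if_then_else_)
import Data.Bool.Properties as BoolP
open import Data.List.Properties using (length-++; length-map)
open import Data.Product using (_×_; _,_; Σ; ∃; proj₁; proj₂; uncurry)
open import Data.Sum using (_⊎_; inj₁; inj₂; [_,_])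
open import Data.Empty using (⊥-elim)
open import Data.Unit using (⊤; tt)
open import Data.List using (List; []; _∷_; length; _++_; map; concat; tabulate; allFin; cartesianProductWith)
open import Data.List.Membership.Propositional.Properties using (∈-cartesianProductWith⁺; ∈-allFin; ∈-++⁺ˡ; ∈-++⁺ʳ)
open import Data.List.Membership.Propositional using (_∈_; _∉_; find; lose)
open import Data.List.Relation.Unary.Any using (Any; here; there; any?)
open import Data.List.Relation.Unary.All as All using (All; []; _∷_)
import Data.List.Relation.Unary.All.Properties as AllP
open import Data.List.Relation.Unary.Unique.Propositional using (Unique)
open import Data.List.Relation.Unary.AllPairs using (AllPairs; []; _∷_)
open import Relation.Binary.Definitions using (DecidableEquality)
open import Function.Base using (_∘_; id; case_of_)
open import Function.Bundles using (Equivalence; _⇔_; mk⇔)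
open import Relation.Nullary using (¬_; Dec; yes; no; does; ¬?)
open import Relation.Nullary.Decidable using (dec-true; dec-false; _×-dec_; _⊎-dec_; map′)
open import Relation.Binary.PropositionalEquality hiding ([_])

⟦_⟧ : Bool → ℤ
⟦ true ⟧  = 1ℤ
⟦ false ⟧ = 0ℤ

⟦_⟧ℕ : Bool → ℕ
⟦ true ⟧ℕ  = 1
⟦ false ⟧ℕ = 0

pos-⟦⟧ : ∀ b → + ⟦ b ⟧ℕ ≡ ⟦ b ⟧
pos-⟦⟧ true  = refl
pos-⟦⟧ false = refl

⟦⟧≥0 : ∀ b → 0ℤ ℤ.≤ ⟦ b ⟧
⟦⟧≥0 true  = ℤ.+≤+ z≤n
⟦⟧≥0 false = ℤP.≤-refl

⟦⟧≤1 : ∀ b → ⟦ b ⟧ ℤ.≤ 1ℤ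
⟦⟧≤1 true  = ℤP.≤-refl
⟦⟧≤1 false = ℤ.+≤+ z≤n

1≤⟦⟧ : ∀ {b} → 1ℤ ℤ.≤ ⟦ b ⟧ → b ≡ true
1≤⟦⟧ {true}  _ = refl
1≤⟦⟧ {false} (ℤ.+≤+ ())

≤⟦⟧+ : ∀ b x → x ℤ.≤ ⟦ b ⟧ + x
≤⟦⟧+ b x = subst (ℤ._≤ ⟦ b ⟧ + x) (ℤP.+-identityˡ x) (ℤP.+-monoˡ-≤ x (⟦⟧≥0 b))

witness : ∀ {a} {A : Set a} (d : Dec A) → T (does d) → A
witness (yes a) _ = a

⟦false∧⟧ : ∀ {a} {A : Set a} {b} (d : Dec A) → ¬ A → ⟦ does d ∧ b ⟧ ≡ 0ℤ
⟦false∧⟧ d ¬a rewrite dec-false d ¬a = refl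

⟦true∧⟧ : ∀ {a} {A : Set a} {b} (d : Dec A) → A → ⟦ does d ∧ b ⟧ ≡ ⟦ b ⟧
⟦true∧⟧ d a rewrite dec-true d a = refl

T-nonzero*bit : ∀ {x b} → x * ⟦ b ⟧ ≢ 0ℤ → T b
T-nonzero*bit {b = true}      _     = tt
T-nonzero*bit {x} {b = false} x0≢0 = ⊥-elim (x0≢0 (ℤP.*-zeroʳ x))

≡ᵇ-refl : ∀ a → (a ≡ᵇ a) ≡ true
≡ᵇ-refl a = dec-true (a ℕP.≟ a) refl

≢⇒≡ᵇ-false : ∀ {a b} → a ≢ b → (a ≡ᵇ b) ≡ false
≢⇒≡ᵇ-false {a} {b} = dec-false (a ℕP.≟ b)

≡ᵇ∧≡ᵇ-sound : ∀ a b c d → ((a ≡ᵇ b) ∧ (c ≡ᵇ d)) ≡ true → a ≡ b × c ≡ d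
≡ᵇ∧≡ᵇ-sound a b c d both with a ≡ᵇ b in ab | c ≡ᵇ d in cd
... | true | true = ℕP.≡ᵇ⇒≡ a b (subst T (sym ab) tt) , ℕP.≡ᵇ⇒≡ c d (subst T (sym cd) tt)

≤⇒≤ᵇ : ∀ {a b} → a ≤ b → (a ℕ.≤ᵇ b) ≡ true
≤⇒≤ᵇ {a} {b} = dec-true (a ℕP.≤? b)

≰⇒≤ᵇ : ∀ {a b} → ¬ a ≤ b → (a ℕ.≤ᵇ b) ≡ false
≰⇒≤ᵇ {a} {b} = dec-false (a ℕP.≤? b)

≤ᵇ⇒≤ : ∀ {a b} → (a ℕ.≤ᵇ b) ≡ true → a ≤ b
≤ᵇ⇒≤ {a} {b} t = ℕP.≤ᵇ⇒≤ a b (subst T (sym t) tt)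

sum-cong : ∀ {n} {f g : Fin n → ℤ} → (∀ i → f i ≡ g i) → sumℤ f ≡ sumℤ g
sum-cong {zero}  f≗g = refl
sum-cong {suc n} f≗g = cong₂ _+_ (f≗g zero) (sum-cong (f≗g ∘ suc))

sum-zero : ∀ {n} {f : Fin n → ℤ} → (∀ i → f i ≡ 0ℤ) → sumℤ f ≡ 0ℤ
sum-zero {zero}  f≗0 = refl
sum-zero {suc n} f≗0 = cong₂ _+_ (f≗0 zero) (sum-zero (f≗0 ∘ suc))

sum-distrib-+ : ∀ {n} (f g : Fin n → ℤ) → sumℤ (λ i → f i + g i) ≡ sumℤ f + sumℤ g
sum-distrib-+ {zero}  f g = refl
sum-distrib-+ {suc n} f g =
  trans (cong (_+_ (f zero + g zero)) (sum-distrib-+ (f ∘ suc) (g ∘ suc)))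
        (interchange (f zero) (g zero) (sumℤ (f ∘ suc)) (sumℤ (g ∘ suc)))
  where
  interchange : ∀ (a b c d : ℤ) → (a + b) + (c + d) ≡ (a + c) + (b + d)
  interchange = solve-∀

sum-neg : ∀ {n} (f : Fin n → ℤ) → sumℤ (λ i → - f i) ≡ - sumℤ f
sum-neg {zero}  f = refl
sum-neg {suc n} f = trans (cong (_+_ (- f zero)) (sum-neg (f ∘ suc)))
                          (sym (ℤP.neg-distrib-+ (f zero) (sumℤ (f ∘ suc))))

sum-distrib-- : ∀ {n} (f g : Fin n → ℤ) → sumℤ (λ i → f i - g i) ≡ sumℤ f - sumℤ g
sum-distrib-- f g = trans (sum-distrib-+ f (λ i → - g i)) (cong (_+_ (sumℤ f)) (sum-neg g))

sum-comm : ∀ {m n} (f : Fin m → Fin n → ℤ) →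
  sumℤ (λ i → sumℤ (f i)) ≡ sumℤ (λ j → sumℤ (λ i → f i j))
sum-comm {zero} {n} f = sym (sum-zero {n} (λ _ → refl))
sum-comm {suc m} f = trans (cong (_+_ (sumℤ (f zero))) (sum-comm (f ∘ suc)))
                           (sym (sum-distrib-+ (f zero) (λ j → sumℤ (λ i → f (suc i) j))))

sum-mono : ∀ {n} {f g : Fin n → ℤ} → (∀ i → f i ℤ.≤ g i) → sumℤ f ℤ.≤ sumℤ g
sum-mono {zero}  f≤g = ℤP.≤-refl
sum-mono {suc n} f≤g = ℤP.+-mono-≤ (f≤g zero) (sum-mono (f≤g ∘ suc))

sum-single : ∀ {n} (f : Fin n → ℤ) (k : Fin n) → (∀ i → i ≢ k → f i ≡ 0ℤ) → sumℤ f ≡ f k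
sum-single {suc n} f zero    f≗0 =
  trans (cong (_+_ (f zero)) (sum-zero (λ i → f≗0 (suc i) λ ()))) (ℤP.+-identityʳ (f zero))
sum-single {suc n} f (suc k) f≗0 =
  trans (cong₂ _+_ (f≗0 zero λ ()) (sum-single (f ∘ suc) k (λ i i≢k → f≗0 (suc i) (i≢k ∘ FinP.suc-injective))))
        (ℤP.+-identityˡ (f (suc k)))

sum-one : ∀ n → sumℤ {n} (λ _ → 1ℤ) ≡ + n
sum-one zero    = refl
sum-one (suc n) = cong (_+_ 1ℤ) (sum-one n)

differences : ∀ {n} → (ℕ → ℤ) → Fin n → ℤ
differences g j = g (toℕ j) - g (suc (toℕ j))

sum-telescope : ∀ m (g : ℕ → ℤ) → sumℤ {m} (differences g) ≡ g 0 - g m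
sum-telescope zero    g = sym (ℤP.+-inverseʳ (g 0))
sum-telescope (suc m) g = trans (cong (_+_ (g 0 - g 1)) (sum-telescope m (g ∘ suc))) (chain (g 0) (g 1) (g (suc m)))
  where
  chain : ∀ (a b c : ℤ) → (a - b) + (b - c) ≡ a - c
  chain = solve-∀

sumUpTo : ℕ → (ℕ → ℤ) → ℤ
sumUpTo zero    F = 0ℤ
sumUpTo (suc m) F = sumUpTo m F + F m

sumUpTo-cong : ∀ m {F G : ℕ → ℤ} → (∀ g → g < m → F g ≡ G g) → sumUpTo m F ≡ sumUpTo m G
sumUpTo-cong zero    F≗G = refl
sumUpTo-cong (suc m) F≗G = cong₂ _+_ (sumUpTo-cong m (λ g g<m → F≗G g (ℕP.m<n⇒m<1+n g<m))) (F≗G m ℕP.≤-refl)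

sumUpTo-zero : ∀ m {F : ℕ → ℤ} → (∀ g → g < m → F g ≡ 0ℤ) → sumUpTo m F ≡ 0ℤ
sumUpTo-zero zero    F≗0 = refl
sumUpTo-zero (suc m) F≗0 = cong₂ _+_ (sumUpTo-zero m (λ g g<m → F≗0 g (ℕP.m<n⇒m<1+n g<m))) (F≗0 m ℕP.≤-refl)

sumUpTo-beyond : ∀ m d {F : ℕ → ℤ} → (∀ g → m ≤ g → F g ≡ 0ℤ) → sumUpTo (m ℕ.+ d) F ≡ sumUpTo m F
sumUpTo-beyond m zero    F≗0 = cong (λ l → sumUpTo l _) (ℕP.+-identityʳ m)
sumUpTo-beyond m (suc d) {F} F≗0 = begin
  sumUpTo (m ℕ.+ suc d) F                ≡⟨ cong (λ l → sumUpTo l F) (ℕP.+-suc m d) ⟩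
  sumUpTo (m ℕ.+ d) F + F (m ℕ.+ d)      ≡⟨ cong₂ _+_ (sumUpTo-beyond m d F≗0) (F≗0 (m ℕ.+ d) (ℕP.m≤m+n m d)) ⟩
  sumUpTo m F + 0ℤ                       ≡⟨ ℤP.+-identityʳ _ ⟩
  sumUpTo m F                            ∎
  where open ≡-Reasoning

sumUpTo-shift : ∀ m (F : ℕ → ℤ) → sumUpTo (suc m) F ≡ F 0 + sumUpTo m (F ∘ suc)
sumUpTo-shift zero    F = trans (ℤP.+-identityˡ (F 0)) (sym (ℤP.+-identityʳ (F 0)))
sumUpTo-shift (suc m) F = trans (cong (_+ F (suc m)) (sumUpTo-shift m F))
                                (ℤP.+-assoc (F 0) (sumUpTo m (F ∘ suc)) (F (suc m)))

sum≡sumUpTo : ∀ m (F : ℕ → ℤ) → sumℤ {m} (F ∘ toℕ) ≡ sumUpTo m F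
sum≡sumUpTo zero    F = refl
sum≡sumUpTo (suc m) F = trans (cong (_+_ (F 0)) (sum≡sumUpTo m (F ∘ suc))) (sym (sumUpTo-shift m F))

falls rises : (ℕ → Bool) → ℕ → ℤ
falls z g = ⟦ z g ∧ not (z (suc g)) ⟧
rises z g = ⟦ not (z g) ∧ z (suc g) ⟧

falls-by-parts : ∀ (z : ℕ → Bool) (f : ℕ → ℤ) m →
  (∀ g → g < m → z g ≡ true → z (suc g) ≡ false → f g ≡ 1ℤ) →
  (∀ g → g < m → z g ≡ false → z (suc g) ≡ true → f g ≡ 0ℤ) →
  sumUpTo m (falls z) ≡ (⟦ z 0 ⟧ * f 0 - ⟦ z m ⟧ * f m) + sumUpTo m (λ g → ⟦ z (suc g) ⟧ * (f (suc g) - f g))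
falls-by-parts z f zero    _    _    = ring (⟦ z 0 ⟧ * f 0)
  where
  ring : ∀ a → 0ℤ ≡ (a - a) + 0ℤ
  ring = solve-∀
falls-by-parts z f (suc m) fall rise =
  trans (cong₂ _+_ (falls-by-parts z f m (λ g g<m → fall g (ℕP.m<n⇒m<1+n g<m)) (λ g g<m → rise g (ℕP.m<n⇒m<1+n g<m)))
                   (step (z m) (z (suc m)) (fall m ℕP.≤-refl) (rise m ℕP.≤-refl)))
        (ring (⟦ z 0 ⟧ * f 0) (⟦ z m ⟧ * f m) ⟦ z (suc m) ⟧ (f m) (f (suc m))
              (sumUpTo m (λ g → ⟦ z (suc g) ⟧ * (f (suc g) - f g))))
  where
  step : ∀ a b → (a ≡ true → b ≡ false → f m ≡ 1ℤ) → (a ≡ false → b ≡ true → f m ≡ 0ℤ) →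
    ⟦ a ∧ not b ⟧ ≡ ⟦ a ⟧ * f m - ⟦ b ⟧ * f m
  step true  true  _    _    = sym (ℤP.+-inverseʳ (1ℤ * f m))
  step true  false fall _    rewrite fall refl refl = refl
  step false true  _    rise rewrite rise refl refl = refl
  step false false _    _    = sym (cong₂ _-_ (ℤP.*-zeroˡ (f m)) (ℤP.*-zeroˡ (f m)))
  ring : ∀ (a z₀f z₁ f₀ f₁ S : ℤ) → ((a - z₀f) + S) + (z₀f - z₁ * f₀) ≡ (a - z₁ * f₁) + (S + z₁ * (f₁ - f₀))
  ring = solve-∀

rises≡falls : ∀ (y : ℕ → Bool) m → sumUpTo m (rises y) ≡ sumUpTo m (falls y) + (⟦ y m ⟧ - ⟦ y 0 ⟧)
rises≡falls y zero    = ring ⟦ y 0 ⟧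
  where
  ring : ∀ a → 0ℤ ≡ 0ℤ + (a - a)
  ring = solve-∀
rises≡falls y (suc m) =
  trans (cong₂ _+_ (rises≡falls y m) (step (y m) (y (suc m))))
        (ring (sumUpTo m (falls y)) ⟦ y m ⟧ ⟦ y 0 ⟧ (falls y m) ⟦ y (suc m) ⟧)
  where
  step : ∀ a b → ⟦ not a ∧ b ⟧ ≡ ⟦ a ∧ not b ⟧ + (⟦ b ⟧ - ⟦ a ⟧)
  step true  true  = refl
  step true  false = refl
  step false true  = refl
  step false false = refl
  ring : ∀ (S yₘ y₀ F y₁ : ℤ) → (S + (yₘ - y₀)) + (F + (y₁ - yₘ)) ≡ (S + F) + (y₁ - y₀)
  ring = solve-∀

FirstNonzero : ∀ {n} → (Fin n → ℤ) → Fin n → Set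
FirstNonzero v f = v f ≢ 0ℤ × (∀ l → l Fin.< f → v l ≡ 0ℤ)

alternates-tail : ∀ {n} {v : Fin (suc n) → ℤ} → Alternates v → Alternates (v ∘ suc)
alternates-tail {v = v} alt j k j<k vj≢0 vk≢0 between =
  alt (suc j) (suc k) (s≤s j<k) vj≢0 vk≢0 between′
  where
  between′ : ∀ l → suc j Fin.< l → l Fin.< suc k → v l ≡ 0ℤ
  between′ (suc l) j<l l<k = between l (s≤s⁻¹ j<l) (s≤s⁻¹ l<k)

-- The nonzero entries cancel in pairs, so what is left is nothing or the first one.
sum-alternating : ∀ {n} (v : Fin n → ℤ) → Alternates v →
  sumℤ v ≡ 0ℤ ⊎ ∃ λ f → FirstNonzero v f × sumℤ v ≡ v f
sum-alternating {zero}  v alt = inj₁ refl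
sum-alternating {suc n} v alt with sum-alternating (v ∘ suc) (alternates-tail alt) | v zero ℤP.≟ 0ℤ
... | inj₁ tail≡0 | yes v₀≡0 = inj₁ (cong₂ _+_ v₀≡0 tail≡0)
... | inj₁ tail≡0 | no  v₀≢0 =
  inj₂ (zero , (v₀≢0 , λ _ ()) , trans (cong (_+_ (v zero)) tail≡0) (ℤP.+-identityʳ (v zero)))
... | inj₂ (f , (vf≢0 , before) , tail≡vf) | yes v₀≡0 =
  inj₂ (suc f , (vf≢0 , before′) , trans (cong₂ _+_ v₀≡0 tail≡vf) (ℤP.+-identityˡ (v (suc f))))
  where
  before′ : ∀ l → l Fin.< suc f → v l ≡ 0ℤ
  before′ zero    _   = v₀≡0
  before′ (suc l) l<f = before l (s≤s⁻¹ l<f)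
... | inj₂ (f , (vf≢0 , before) , tail≡vf) | no v₀≢0 =
  inj₁ (begin
    v zero + sumℤ (v ∘ suc) ≡⟨ cong (_+_ (v zero)) (trans tail≡vf next≡-v₀) ⟩
    v zero - v zero         ≡⟨ ℤP.+-inverseʳ (v zero) ⟩
    0ℤ                      ∎)
  where
  open ≡-Reasoning
  between : ∀ l → zero {n} Fin.< l → l Fin.< suc f → v l ≡ 0ℤ
  between (suc l) _ l<f = before l (s≤s⁻¹ l<f)
  next≡-v₀ : v (suc f) ≡ - v zero
  next≡-v₀ = alt zero (suc f) (s≤s z≤n) v₀≢0 vf≢0 between

sign≤1 : ∀ {x} → IsSignEntry x → x ℤ.≤ 1ℤ
sign≤1 (inj₁ refl)        = ℤ.+≤+ z≤n
sign≤1 (inj₂ (inj₁ refl)) = ℤP.≤-refl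
sign≤1 (inj₂ (inj₂ refl)) = ℤ.-≤+

sum-alternating≤1 : ∀ {n} (v : Fin n → ℤ) → (∀ j → IsSignEntry (v j)) → Alternates v → sumℤ v ℤ.≤ 1ℤ
sum-alternating≤1 v sign alt with sum-alternating v alt
... | inj₁ sum≡0            = ℤP.≤-trans (ℤP.≤-reflexive sum≡0) (ℤ.+≤+ z≤n)
... | inj₂ (f , _ , sum≡vf) = ℤP.≤-trans (ℤP.≤-reflexive sum≡vf) (sign≤1 (sign f))

sign*bit : ∀ {x} → IsSignEntry x → ∀ b → IsSignEntry (x * ⟦ b ⟧)
sign*bit {x} sign true  = subst IsSignEntry (sym (ℤP.*-identityʳ x)) sign
sign*bit {x} sign false = inj₁ (ℤP.*-zeroʳ x)

module _ {n : ℕ} (lo hi : Fin n) where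

  restrict : (Fin n → ℤ) → Fin n → ℤ
  restrict v j = v j * ⟦ does (lo Fin.≤? j) ∧ does (j Fin.≤? hi) ⟧

  restrict-inside : ∀ v {j} → lo Fin.≤ j → j Fin.≤ hi → restrict v j ≡ v j
  restrict-inside v {j} lo≤j j≤hi
    rewrite dec-true (lo Fin.≤? j) lo≤j | dec-true (j Fin.≤? hi) j≤hi = ℤP.*-identityʳ (v j)

  restrict-support : ∀ v {j} → restrict v j ≢ 0ℤ → lo Fin.≤ j × j Fin.≤ hi
  restrict-support v {j} r≢0 =
    witness (lo Fin.≤? j) (proj₁ inside) , witness (j Fin.≤? hi) (proj₂ inside)
    where inside = Equivalence.to (BoolP.T-∧ {does (lo Fin.≤? j)}) (T-nonzero*bit {v j} r≢0)

  alternates-restrict : ∀ {v} → Alternates v → Alternates (restrict v)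
  alternates-restrict {v} alt j k j<k rj≢0 rk≢0 between = begin
    restrict v k ≡⟨ restrict-inside v lo≤k k≤hi ⟩
    v k          ≡⟨ alt j k j<k (rj≢0 ∘ trans rj≡vj) (rk≢0 ∘ trans rk≡vk) between′ ⟩
    - v j        ≡⟨ cong -_ rj≡vj ⟨
    - restrict v j ∎
    where
    open ≡-Reasoning
    lo≤j = proj₁ (restrict-support v rj≢0)
    k≤hi = proj₂ (restrict-support v rk≢0)
    lo≤k = ℕP.≤-trans lo≤j (ℕP.<⇒≤ j<k)
    rj≡vj = restrict-inside v lo≤j (ℕP.≤-trans (ℕP.<⇒≤ j<k) k≤hi)
    rk≡vk = restrict-inside v lo≤k k≤hi
    between′ : ∀ l → j Fin.< l → l Fin.< k → v l ≡ 0ℤ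
    between′ l j<l l<k =
      trans (sym (restrict-inside v (ℕP.≤-trans lo≤j (ℕP.<⇒≤ j<l)) (ℕP.≤-trans (ℕP.<⇒≤ l<k) k≤hi)))
            (between l j<l l<k)

  sum-restrict≤1 : ∀ v → (∀ j → IsSignEntry (v j)) → Alternates v → sumℤ (restrict v) ℤ.≤ 1ℤ
  sum-restrict≤1 v sign alt =
    sum-alternating≤1 (restrict v) (λ j → sign*bit (sign j) _) (alternates-restrict alt)

Bit : ℤ → Set
Bit x = x ≡ 0ℤ ⊎ x ≡ 1ℤ

bit≤1 : ∀ {x} → Bit x → x ℤ.≤ 1ℤ
bit≤1 (inj₁ refl) = ℤ.+≤+ z≤n
bit≤1 (inj₂ refl) = ℤP.≤-refl

bits-full : ∀ {m} (f : Fin m → ℤ) → (∀ i → Bit (f i)) → sumℤ f ≡ + m → ∀ i → f i ≡ 1ℤ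
bits-full {suc m} f bit total i with bit zero
... | inj₁ f₀≡0 = ⊥-elim (ℕP.<-irrefl refl (ℤP.drop‿+≤+ (begin
  + suc m                ≡⟨ total ⟨
  f zero + sumℤ (f ∘ suc) ≡⟨ cong (_+ sumℤ (f ∘ suc)) f₀≡0 ⟩
  0ℤ + sumℤ (f ∘ suc)    ≡⟨ ℤP.+-identityˡ _ ⟩
  sumℤ (f ∘ suc)         ≤⟨ sum-mono (bit≤1 ∘ bit ∘ suc) ⟩
  sumℤ {m} (λ _ → 1ℤ)    ≡⟨ sum-one m ⟩
  + m                    ∎)))
  where open ℤP.≤-Reasoning
... | inj₂ f₀≡1 with i
...   | zero   = f₀≡1
...   | suc i′ = bits-full (f ∘ suc) (bit ∘ suc) tail≡m i′
  where
  cancel : ∀ a s → s ≡ (a + s) - a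
  cancel = solve-∀
  tail≡m : sumℤ (f ∘ suc) ≡ + m
  tail≡m = trans (cancel (f zero) (sumℤ (f ∘ suc))) (cong₂ _-_ total f₀≡1)

bit-difference : ∀ {a b} → Bit a → Bit b → IsSignEntry (a - b)
bit-difference (inj₁ refl) (inj₁ refl) = inj₁ refl
bit-difference (inj₁ refl) (inj₂ refl) = inj₂ (inj₂ refl)
bit-difference (inj₂ refl) (inj₁ refl) = inj₂ (inj₁ refl)
bit-difference (inj₂ refl) (inj₂ refl) = inj₁ refl

bit-differences-alternate : ∀ {p q r} → Bit p → Bit q → Bit r → p - q ≢ 0ℤ → q - r ≢ 0ℤ → q - r ≡ - (p - q)
bit-differences-alternate (inj₁ refl) (inj₁ refl) _           p≢q _   = ⊥-elim (p≢q refl)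
bit-differences-alternate (inj₂ refl) (inj₂ refl) _           p≢q _   = ⊥-elim (p≢q refl)
bit-differences-alternate (inj₁ refl) (inj₂ refl) (inj₁ refl) _   _   = refl
bit-differences-alternate (inj₁ refl) (inj₂ refl) (inj₂ refl) _   q≢r = ⊥-elim (q≢r refl)
bit-differences-alternate (inj₂ refl) (inj₁ refl) (inj₁ refl) _   q≢r = ⊥-elim (q≢r refl)
bit-differences-alternate (inj₂ refl) (inj₁ refl) (inj₂ refl) _   _   = refl

steady : ∀ (g : ℕ → ℤ) {j k} → j < k → (∀ l → j < l → l < k → g l ≡ g (suc l)) → g (suc j) ≡ g k
steady g {j} {suc k} (s≤s j≤k) flat with ℕP.m≤n⇒m<n∨m≡n j≤k
... | inj₂ refl = refl
... | inj₁ j<k  = trans (steady g j<k (λ l j<l l<k → flat l j<l (ℕP.m<n⇒m<1+n l<k))) (flat k j<k ℕP.≤-refl)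

module _ {n : ℕ} where

  -- Between two nonzero differences g is constant, so they are p - q and q - r for bits p, q, r.
  alternates-differences : ∀ g → (∀ m → Bit (g m)) → Alternates (differences {n} g)
  alternates-differences g bit j k j<k dj≢0 dk≢0 between =
    subst (λ q → q - g (suc (toℕ k)) ≡ - differences g j) (sym gk≡gj+1)
      (bit-differences-alternate (bit _) (bit _) (bit _) dj≢0 (subst (λ q → q - g (suc (toℕ k)) ≢ 0ℤ) gk≡gj+1 dk≢0))
    where
    flat : ∀ l → toℕ j < l → l < toℕ k → g l ≡ g (suc l)
    flat l j<l l<k = ℤP.i-j≡0⇒i≡j (g l) (g (suc l)) (subst (λ m → g m - g (suc m) ≡ 0ℤ) L≡l
      (between L (subst (toℕ j <_) (sym L≡l) j<l) (subst (_< toℕ k) (sym L≡l) l<k)))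
      where
      l<n = ℕP.<-trans l<k (FinP.toℕ<n k)
      L = fromℕ< l<n
      L≡l = FinP.toℕ-fromℕ< l<n
    gk≡gj+1 : g (toℕ k) ≡ g (suc (toℕ j))
    gk≡gj+1 = sym (steady g j<k flat)

  alternates-neg : ∀ {f : Fin n → ℤ} → Alternates f → Alternates (λ i → - f i)
  alternates-neg {f} alt j k j<k nj nk between =
    cong (λ x → - x) (alt j k j<k (nj ∘ cong (λ x → - x)) (nk ∘ cong (λ x → - x))
                 (λ l j<l l<k → trans (sym (ℤP.neg-involutive (f l))) (cong (λ x → - x) (between l j<l l<k))))

  alternates-cong : ∀ {f g : Fin n → ℤ} → (∀ i → f i ≡ g i) → Alternates g → Alternates f
  alternates-cong f≗g alt j k j<k nj nk between =
    trans (f≗g k) (trans (alt j k j<k (nj ∘ trans (f≗g j)) (nk ∘ trans (f≗g k))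
                                  (λ l j<l l<k → trans (sym (f≗g l)) (between l j<l l<k)))
                         (cong (λ x → - x) (sym (f≗g j))))

-- The covering bound for alternating sign matrices

EntryCondition : Block → ℤ → Set
EntryCondition S0 x = x ≡ 0ℤ
EntryCondition S+ x = 0ℤ ℤ.≤ x
EntryCondition S- x = x ℤ.≤ 0ℤ
EntryCondition SF x = ⊤

CoverCondition : Block → ℕ → Set
CoverCondition S0 k = ⊤
CoverCondition S+ k = 1 ≤ k
CoverCondition S- k = k ≤ 1
CoverCondition SF k = k ≡ 1

module _ {n : ℕ} (P : Partition n) where

  respects⇒entryCondition : ∀ {A} → Respects P A → ∀ i j → EntryCondition (P (i , j)) (A i j)
  respects⇒entryCondition resp i j with P (i , j) | resp (i , j)
  ... | S0 | c = c
  ... | S+ | c = c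
  ... | S- | c = c
  ... | SF | _ = tt

  entryCondition⇒respects : ∀ {A} → (∀ i j → EntryCondition (P (i , j)) (A i j)) → Respects P A
  entryCondition⇒respects cond (i , j) with P (i , j) | cond i j
  ... | S0 | c = c
  ... | S+ | c = c
  ... | S- | c = c
  ... | SF | _ = tt

  admissible⇒coverCondition : ∀ {I} → AdmissibleCover P I → ∀ p → CoverCondition (P p) (cover I p)
  admissible⇒coverCondition adm p with P p | adm p
  ... | S0 | _ = tt
  ... | S+ | c = c
  ... | S- | c = c
  ... | SF | c = c

  coverCondition⇒admissible : ∀ {I} → (∀ p → CoverCondition (P p) (cover I p)) → AdmissibleCover P I
  coverCondition⇒admissible cond p with P p | cond p
  ... | S0 | _ = tt
  ... | S+ | c = c
  ... | S- | c = c
  ... | SF | c = c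

covered-once : ∀ b → CoverCondition b 1
covered-once S0 = tt
covered-once S+ = s≤s z≤n
covered-once S- = s≤s z≤n
covered-once SF = refl

entry≤entry*cover : ∀ b {x} c → IsSignEntry x → EntryCondition b x → CoverCondition b c → x ℤ.≤ x * + c
entry≤entry*cover b  c (inj₁ refl)        _          _    = ℤP.≤-reflexive (sym (ℤP.*-zeroˡ (+ c)))
entry≤entry*cover S0 c (inj₂ (inj₁ refl)) ()         _
entry≤entry*cover S+ c (inj₂ (inj₁ refl)) _          1≤c  = subst (1ℤ ℤ.≤_) (sym (ℤP.*-identityˡ (+ c))) (ℤ.+≤+ 1≤c)
entry≤entry*cover S- c (inj₂ (inj₁ refl)) (ℤ.+≤+ ()) _
entry≤entry*cover SF c (inj₂ (inj₁ refl)) _          refl = ℤP.≤-refl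
entry≤entry*cover S0 c (inj₂ (inj₂ refl)) ()         _
entry≤entry*cover S+ c (inj₂ (inj₂ refl)) ()         _
entry≤entry*cover S- 0 (inj₂ (inj₂ refl)) _          _    = ℤ.-≤+
entry≤entry*cover S- 1 (inj₂ (inj₂ refl)) _          _    = ℤP.≤-refl
entry≤entry*cover S- (suc (suc c)) (inj₂ (inj₂ refl)) _ (s≤s ())
entry≤entry*cover SF c (inj₂ (inj₂ refl)) _          refl = ℤP.≤-refl

countℤ : ∀ {S X : Set} → (S → X → ℤ) → List S → X → ℤ
countℤ ind []       x = 0ℤ
countℤ ind (s ∷ ss) x = ind s x + countℤ ind ss x

coverBy : ∀ {n} {S : Set} {_∈ₛ_ : Pos n → S → Set} → (∀ p s → Dec (p ∈ₛ s)) → List S → Pos n → ℤ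
coverBy _∈ₛ?_ = countℤ (λ s p → ⟦ does (p ∈ₛ? s) ⟧)

countHℤ : ∀ {n} → List (HSeg n) → Pos n → ℤ
countHℤ = coverBy _∈H?_

countH≡countHℤ : ∀ {n} (p : Pos n) ss → + countH p ss ≡ countHℤ ss p
countH≡countHℤ p []       = refl
countH≡countHℤ p (s ∷ ss) with p ∈H? s
... | yes p∈s = trans (cong (_+_ 1ℤ) (countH≡countHℤ p ss))
                      (cong (λ b → ⟦ b ⟧ + _) (sym (dec-true (p ∈H? s) p∈s)))
... | no  p∉s = trans (trans (countH≡countHℤ p ss) (sym (ℤP.+-identityˡ _)))
                      (cong (λ b → ⟦ b ⟧ + _) (sym (dec-false (p ∈H? s) p∉s)))

countVℤ : ∀ {n} → List (VSeg n) → Pos n → ℤ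
countVℤ = coverBy _∈V?_

countV≡countVℤ : ∀ {n} (p : Pos n) ss → + countV p ss ≡ countVℤ ss p
countV≡countVℤ p []       = refl
countV≡countVℤ p (s ∷ ss) with p ∈V? s
... | yes p∈s = trans (cong (_+_ 1ℤ) (countV≡countVℤ p ss))
                      (cong (λ b → ⟦ b ⟧ + _) (sym (dec-true (p ∈V? s) p∈s)))
... | no  p∉s = trans (trans (countV≡countVℤ p ss) (sym (ℤP.+-identityˡ _)))
                      (cong (λ b → ⟦ b ⟧ + _) (sym (dec-false (p ∈V? s) p∉s)))

module _ {n : ℕ} (A : Matrix n) where

  weight : (Pos n → ℤ) → ℤ
  weight c = sumℤ (λ i → sumℤ (λ j → A i j * c (i , j)))

  weight-cong : ∀ {c d} → (∀ p → c p ≡ d p) → weight c ≡ weight d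
  weight-cong c≗d = sum-cong (λ i → sum-cong (λ j → cong (A i j *_) (c≗d (i , j))))

  weight-+ : ∀ c d → weight (λ p → c p + d p) ≡ weight c + weight d
  weight-+ c d =
    trans (sum-cong (λ i → trans (sum-cong (λ j → ℤP.*-distribˡ-+ (A i j) (c (i , j)) (d (i , j))))
                                 (sum-distrib-+ (λ j → A i j * c (i , j)) (λ j → A i j * d (i , j)))))
          (sum-distrib-+ (λ i → sumℤ (λ j → A i j * c (i , j))) (λ i → sumℤ (λ j → A i j * d (i , j))))

  weight-count≤length : ∀ {S : Set} (ind : S → Pos n → ℤ) → (∀ s → weight (ind s) ℤ.≤ 1ℤ) →
    ∀ ss → weight (countℤ ind ss) ℤ.≤ + length ss
  weight-count≤length ind w≤1 []       =
    ℤP.≤-reflexive (sum-zero (λ i → sum-zero (λ j → ℤP.*-zeroʳ (A i j))))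
  weight-count≤length ind w≤1 (s ∷ ss) =
    ℤP.≤-trans (ℤP.≤-reflexive (weight-+ (ind s) (countℤ ind ss)))
               (ℤP.+-mono-≤ (w≤1 s) (weight-count≤length ind w≤1 ss))

  module _ (asm : IsASM A) where
    open IsASM asm

    hseg-weight≤1 : ∀ s → weight (λ p → ⟦ does (p ∈H? s) ⟧) ℤ.≤ 1ℤ
    hseg-weight≤1 s@(hseg r lo hi _) =
      ℤP.≤-trans (ℤP.≤-reflexive row-r) (sum-restrict≤1 lo hi (A r) (entries r) (rowAlt r))
      where
      row-r : weight (λ p → ⟦ does (p ∈H? s) ⟧) ≡ sumℤ (restrict lo hi (A r))
      row-r = trans (sum-single _ r (λ i i≢r → sum-zero (λ j →
                      trans (cong (A i j *_) (⟦false∧⟧ (i Fin.≟ r) i≢r)) (ℤP.*-zeroʳ (A i j)))))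
                    (sum-cong (λ j → cong (A r j *_) (⟦true∧⟧ (r Fin.≟ r) refl)))

    vseg-weight≤1 : ∀ s → weight (λ p → ⟦ does (p ∈V? s) ⟧) ℤ.≤ 1ℤ
    vseg-weight≤1 s@(vseg c lo hi _) =
      ℤP.≤-trans (ℤP.≤-reflexive column-c)
                 (sum-restrict≤1 lo hi (λ i → A i c) (λ i → entries i c) (colAlt c))
      where
      column-c : weight (λ p → ⟦ does (p ∈V? s) ⟧) ≡ sumℤ (restrict lo hi (λ i → A i c))
      column-c = sum-cong (λ i → trans (sum-single _ c (λ j j≢c →
                                         trans (cong (A i j *_) (⟦false∧⟧ (j Fin.≟ c) j≢c)) (ℤP.*-zeroʳ (A i j))))
                                       (cong (A i c *_) (⟦true∧⟧ (c Fin.≟ c) refl)))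

    asm⇒cover-bound : (P : Partition n) → Respects P A → (I : Family n) → AdmissibleCover P I →
      n ≤ size I
    asm⇒cover-bound P resp I adm = ℤP.drop‿+≤+ (begin
      + n                                      ≡⟨ sum-one n ⟨
      sumℤ {n} (λ _ → 1ℤ)                      ≡⟨ sum-cong rowSum ⟨
      sumℤ (λ i → sumℤ (A i))                  ≤⟨ sum-mono (λ i → sum-mono (λ j → A≤A*cover i j)) ⟩
      weight (λ p → + cover I p)               ≡⟨ weight-cong cover-split ⟩
      weight (λ p → countHℤ hor p + countVℤ ver p)
                                               ≡⟨ weight-+ (countHℤ hor) (countVℤ ver) ⟩
      weight (countHℤ hor) + weight (countVℤ ver)
                                               ≤⟨ ℤP.+-mono-≤ (weight-count≤length _ hseg-weight≤1 hor)
                                                              (weight-count≤length _ vseg-weight≤1 ver) ⟩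
      + length hor + + length ver              ∎)
      where
      open ℤP.≤-Reasoning
      open Family I
      A≤A*cover : ∀ i j → A i j ℤ.≤ A i j * + cover I (i , j)
      A≤A*cover i j = entry≤entry*cover (P (i , j)) (cover I (i , j)) (entries i j)
                        (respects⇒entryCondition P resp i j) (admissible⇒coverCondition P {I} adm (i , j))
      cover-split : ∀ p → + cover I p ≡ countHℤ hor p + countVℤ ver p
      cover-split p = cong₂ _+_ (countH≡countHℤ p hor) (countV≡countVℤ p ver)

-- Simple paths and cuts in a finite digraph

module Reachability {Node : Set} (_≟_ : DecidableEquality Node)
                    (allNodes : List Node) (complete : ∀ u → u ∈ allNodes)
                    (Arc : Node → Node → Set) (arc? : ∀ a b → Dec (Arc a b)) (s t : Node) where

  open import Data.List.Membership.DecPropositional _≟_ using (_∈?_)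

  data Walk : Node → Set where
    start : Walk s
    _▷_   : ∀ {a b} → Walk a → Arc a b → Walk b

  visited : ∀ {u} → Walk u → List Node
  visited start            = s ∷ []
  visited (_▷_ {b = b} w _) = b ∷ visited w

  Closed : List Node → Set
  Closed V = ∀ {a b} → a ∈ V → Arc a b → b ∈ V

  SimplePath : Set
  SimplePath = Σ (Walk t) (Unique ∘ visited)

  Cut : Set
  Cut = Σ (List Node) λ V → s ∈ V × t ∉ V × Closed V

  private
    SimpleWalkWithin : List Node → Node → Set
    SimpleWalkWithin V u = Σ (Walk u) λ w → Unique (visited w) × (∀ {x} → x ∈ visited w → x ∈ V)

    extend : ∀ {V a b} → SimpleWalkWithin V a → b ∉ V → Arc a b → SimpleWalkWithin (b ∷ V) b
    extend {V} {b = b} (w , unique , within) b∉V x = w ▷ x , All.tabulate b≢ ∷ unique , within′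
      where
      b≢ : ∀ {y} → y ∈ visited w → b ≢ y
      b≢ y∈w refl = b∉V (within y∈w)
      within′ : ∀ {y} → y ∈ b ∷ visited w → y ∈ b ∷ V
      within′ (here y≡b)  = here y≡b
      within′ (there y∈w) = there (within y∈w)

    weaken : ∀ {V b u} → SimpleWalkWithin V u → SimpleWalkWithin (b ∷ V) u
    weaken (w , unique , within) = w , unique , there ∘ within

    miss : ∀ {A : Set} → Dec A → ℕ
    miss (yes _) = 0
    miss (no _)  = 1

    miss≤1 : ∀ {A : Set} (a? : Dec A) → miss a? ≤ 1
    miss≤1 (yes _) = z≤n
    miss≤1 (no _)  = s≤s z≤n

    miss-mono : ∀ {A B : Set} (a? : Dec A) (b? : Dec B) → (B → A) → miss a? ≤ miss b?
    miss-mono (yes _) _       _   = z≤n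
    miss-mono (no ¬a) (yes b) b→a = ⊥-elim (¬a (b→a b))
    miss-mono (no _)  (no _)  _   = ℕP.≤-refl

    miss-strict : ∀ {A B : Set} (a? : Dec A) (b? : Dec B) → A → ¬ B → miss a? < miss b?
    miss-strict (yes _) (no _)  _ _  = s≤s z≤n
    miss-strict (no ¬a) _       a _  = ⊥-elim (¬a a)
    miss-strict (yes _) (yes b) _ ¬b = ⊥-elim (¬b b)

    unvisitedIn : List Node → List Node → ℕ
    unvisitedIn V []       = 0
    unvisitedIn V (x ∷ xs) = miss (x ∈? V) ℕ.+ unvisitedIn V xs

    unvisited≤length : ∀ V xs → unvisitedIn V xs ≤ length xs
    unvisited≤length V []       = z≤n
    unvisited≤length V (x ∷ xs) = ℕP.+-mono-≤ (miss≤1 (x ∈? V)) (unvisited≤length V xs)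

    unvisited-mono : ∀ b V xs → unvisitedIn (b ∷ V) xs ≤ unvisitedIn V xs
    unvisited-mono b V []       = z≤n
    unvisited-mono b V (x ∷ xs) =
      ℕP.+-mono-≤ (miss-mono (x ∈? b ∷ V) (x ∈? V) there) (unvisited-mono b V xs)

    unvisited-shrinks : ∀ b V xs → b ∈ xs → b ∉ V → unvisitedIn (b ∷ V) xs < unvisitedIn V xs
    unvisited-shrinks b V (x ∷ xs) (here refl) b∉V =
      ℕP.+-mono-<-≤ (miss-strict (x ∈? x ∷ V) (x ∈? V) (here refl) b∉V) (unvisited-mono x V xs)
    unvisited-shrinks b V (x ∷ xs) (there b∈xs) b∉V =
      ℕP.+-mono-≤-< (miss-mono (x ∈? b ∷ V) (x ∈? V) there) (unvisited-shrinks b V xs b∈xs b∉V)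

    ExitArc : List Node → Set
    ExitArc V = Any (λ a → Any (λ b → b ∉ V × Arc a b) allNodes) V

    exitArc? : ∀ V → Dec (ExitArc V)
    exitArc? V = any? (λ a → any? (λ b → ¬? (b ∈? V) ×-dec arc? a b) allNodes) V

    -- Each round adds a node outside V, so the number of unvisited nodes bounds the rounds.
    grow : (fuel : ℕ) (V : List Node) → unvisitedIn V allNodes ≤ fuel → s ∈ V →
           (∀ {u} → u ∈ V → SimpleWalkWithin V u) → SimplePath ⊎ Cut
    grow fuel V bound s∈V walkTo with t ∈? V
    ... | yes t∈V = inj₁ (proj₁ (walkTo t∈V) , proj₁ (proj₂ (walkTo t∈V)))
    ... | no  t∉V with exitArc? V
    ...   | no noExit = inj₂ (V , s∈V , t∉V , closed)
      where
      closed : Closed V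
      closed {b = b} a∈V x with b ∈? V
      ... | yes b∈V = b∈V
      ... | no  b∉V = ⊥-elim (noExit (lose a∈V (lose (complete b) (b∉V , x))))
    grow zero V bound s∈V walkTo | no t∉V | yes exit
      with a , a∈V , exit′ ← find exit
      with b , _ , b∉V , x ← find exit′ =
      ⊥-elim (ℕP.n≮0 (ℕP.<-≤-trans (unvisited-shrinks b V allNodes (complete b) b∉V) bound))
    grow (suc fuel) V bound s∈V walkTo | no t∉V | yes exit
      with a , a∈V , exit′ ← find exit
      with b , _ , b∉V , x ← find exit′ =
      grow fuel (b ∷ V) (ℕP.<⇒≤pred (ℕP.<-≤-trans (unvisited-shrinks b V allNodes (complete b) b∉V) bound))
           (there s∈V) walkTo′
      where
      walkTo′ : ∀ {u} → u ∈ b ∷ V → SimpleWalkWithin (b ∷ V) u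
      walkTo′ (here refl) = extend (walkTo a∈V) b∉V x
      walkTo′ (there u∈V) = weaken (walkTo u∈V)

  path-or-cut : SimplePath ⊎ Cut
  path-or-cut = grow (length allNodes) (s ∷ []) (unvisited≤length (s ∷ []) allNodes) (here refl) walkTo
    where
    walkTo : ∀ {u} → u ∈ s ∷ [] → SimpleWalkWithin (s ∷ []) u
    walkTo (here refl) = start , [] ∷ [] , id

  ArcWeight : Set
  ArcWeight = ∀ {a b} → Arc a b → ℤ

  ArcCount : Set
  ArcCount = ∀ {a b} → Arc a b → ℕ

  walkSum : ∀ {u} → ArcWeight → Walk u → ℤ
  walkSum f start   = 0ℤ
  walkSum f (w ▷ x) = walkSum f w + f x

  walkCount : ∀ {u} → ArcCount → Walk u → ℕ
  walkCount m start   = 0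
  walkCount m (w ▷ x) = walkCount m w ℕ.+ m x

  walkSum-telescope : ∀ (φ : Node → ℤ) {u} (w : Walk u) → walkSum (λ {a} {b} _ → φ b - φ a) w ≡ φ u - φ s
  walkSum-telescope φ start = sym (ℤP.+-inverseʳ (φ s))
  walkSum-telescope φ (_▷_ {a} {b} w x) =
    trans (cong (_+ (φ b - φ a)) (walkSum-telescope φ w)) (chain (φ a) (φ s) (φ b))
    where
    chain : ∀ (p q r : ℤ) → (p - q) + (r - p) ≡ r - q
    chain = solve-∀

  walkSum-cong : ∀ {u} {f g : ArcWeight} → (∀ {a b} (x : Arc a b) → f x ≡ g x) →
    (w : Walk u) → walkSum f w ≡ walkSum g w
  walkSum-cong f≗g start   = refl
  walkSum-cong f≗g (w ▷ x) = cong₂ _+_ (walkSum-cong f≗g w) (f≗g x)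

  walkSum-distrib-+ : ∀ {u} (f g : ArcWeight) (w : Walk u) →
    walkSum (λ x → f x + g x) w ≡ walkSum f w + walkSum g w
  walkSum-distrib-+ f g start   = refl
  walkSum-distrib-+ f g (w ▷ x) =
    trans (cong (_+ (f x + g x)) (walkSum-distrib-+ f g w)) (interchange (walkSum f w) (walkSum g w) (f x) (g x))
    where
    interchange : ∀ (p q r t : ℤ) → (p + q) + (r + t) ≡ (p + r) + (q + t)
    interchange = solve-∀

  walkSum-distrib-- : ∀ {u} (f g : ArcWeight) (w : Walk u) →
    walkSum (λ x → f x - g x) w ≡ walkSum f w - walkSum g w
  walkSum-distrib-- f g start   = refl
  walkSum-distrib-- f g (w ▷ x) =
    trans (cong (_+ (f x - g x)) (walkSum-distrib-- f g w)) (interchange (walkSum f w) (walkSum g w) (f x) (g x))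
    where
    interchange : ∀ (p q r t : ℤ) → (p - q) + (r - t) ≡ (p + r) - (q + t)
    interchange = solve-∀

  walkSum-count : ∀ {u} (m : ArcCount) (w : Walk u) → walkSum (λ x → + m x) w ≡ + walkCount m w
  walkSum-count m start   = refl
  walkSum-count m (w ▷ x) = cong (_+ + m x) (walkSum-count m w)

  walkSum-sum : ∀ {k u} (f : Fin k → ArcWeight) (w : Walk u) →
    sumℤ (λ i → walkSum (f i) w) ≡ walkSum (λ x → sumℤ (λ i → f i x)) w
  walkSum-sum {k} f start   = sum-zero {k} (λ _ → refl)
  walkSum-sum     f (w ▷ x) = trans (sum-distrib-+ (λ i → walkSum (f i) w) (λ i → f i x))
                                    (cong (_+ sumℤ (λ i → f i x)) (walkSum-sum f w))

  walkCount-zero : ∀ {u} (m : ArcCount) → (∀ {a b} (x : Arc a b) → m x ≡ 0) → (w : Walk u) → walkCount m w ≡ 0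
  walkCount-zero m m≗0 start   = refl
  walkCount-zero m m≗0 (w ▷ x) = cong₂ ℕ._+_ (walkCount-zero m m≗0 w) (m≗0 x)

  AtMostOne : (Node → Bool) → Set
  AtMostOne Q = ∀ a b → Q a ≡ true → Q b ≡ true → a ≡ b

  CountsExitsFrom : ArcCount → (Node → Bool) → Set → Set
  CountsExitsFrom m Q C = ∀ {a b} (x : Arc a b) → m x ≡ 0 ⊎ (m x ≡ 1 × Q a ≡ true × C)

  occurrences : (Node → Bool) → List Node → ℕ
  occurrences Q []       = 0
  occurrences Q (x ∷ xs) = ⟦ Q x ⟧ℕ ℕ.+ occurrences Q xs

  occurrences-none : ∀ Q xs → All (λ y → Q y ≡ false) xs → occurrences Q xs ≡ 0
  occurrences-none Q []       []         = refl
  occurrences-none Q (x ∷ xs) (Qx ∷ Qxs) = cong₂ ℕ._+_ (cong ⟦_⟧ℕ Qx) (occurrences-none Q xs Qxs)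

  occurrences-unique≤1 : ∀ Q → AtMostOne Q → ∀ xs → Unique xs → occurrences Q xs ≤ 1
  occurrences-unique≤1 Q one []       _              = z≤n
  occurrences-unique≤1 Q one (x ∷ xs) (x∉xs ∷ uniq) with Q x in Qx
  ... | false = occurrences-unique≤1 Q one xs uniq
  ... | true  = ℕP.≤-reflexive (cong suc (occurrences-none Q xs (All.map ¬Q x∉xs)))
    where
    ¬Q : ∀ {y} → x ≢ y → Q y ≡ false
    ¬Q {y} x≢y with Q y in Qy
    ... | false = refl
    ... | true  = ⊥-elim (x≢y (one x y Qx Qy))

  count+end≤occurrences : ∀ (m : ArcCount) Q C → CountsExitsFrom m Q C → ∀ {u} (w : Walk u) →
    walkCount m w ℕ.+ ⟦ Q u ⟧ℕ ≤ occurrences Q (visited w)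
  count+end≤occurrences m Q C exits start = ℕP.≤-reflexive (ℕP.+-comm 0 ⟦ Q s ⟧ℕ)
  count+end≤occurrences m Q C exits (_▷_ {a} {b} w x) with exits x
  ... | inj₁ mx≡0 rewrite mx≡0 | ℕP.+-identityʳ (walkCount m w) =
    ℕP.≤-trans (ℕP.≤-reflexive (ℕP.+-comm (walkCount m w) ⟦ Q b ⟧ℕ))
               (ℕP.+-monoʳ-≤ ⟦ Q b ⟧ℕ (ℕP.≤-trans (ℕP.m≤m+n (walkCount m w) ⟦ Q a ⟧ℕ)
                                                  (count+end≤occurrences m Q C exits w)))
  ... | inj₂ (mx≡1 , Qa , _) rewrite mx≡1 =
    ℕP.≤-trans (ℕP.≤-reflexive (ℕP.+-comm (walkCount m w ℕ.+ 1) ⟦ Q b ⟧ℕ))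
               (ℕP.+-monoʳ-≤ ⟦ Q b ⟧ℕ (subst (λ q → walkCount m w ℕ.+ ⟦ q ⟧ℕ ≤ occurrences Q (visited w)) Qa
                                             (count+end≤occurrences m Q C exits w)))

  count≢0⇒condition : ∀ (m : ArcCount) Q C → CountsExitsFrom m Q C → ∀ {u} (w : Walk u) → walkCount m w ≢ 0 → C
  count≢0⇒condition m Q C exits start   m≢0 = ⊥-elim (m≢0 refl)
  count≢0⇒condition m Q C exits (w ▷ x) m≢0 with exits x
  ... | inj₁ mx≡0 = count≢0⇒condition m Q C exits w
                      (λ m≡0 → m≢0 (trans (cong (walkCount m w ℕ.+_) mx≡0) (trans (ℕP.+-identityʳ _) m≡0)))
  ... | inj₂ (_ , _ , c) = c

  -- A simple walk leaves the only node satisfying Q at most once.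
  simpleWalk-count≤1 : ∀ (m : ArcCount) Q C → AtMostOne Q → CountsExitsFrom m Q C →
    ∀ {u} (w : Walk u) → Unique (visited w) → walkCount m w ≡ 0 ⊎ (walkCount m w ≡ 1 × C)
  simpleWalk-count≤1 m Q C one exits {u} w uniq with walkCount m w in eq
  ... | zero        = inj₁ refl
  ... | suc zero    = inj₂ (refl , count≢0⇒condition m Q C exits w (λ m≡0 → case trans (sym eq) m≡0 of λ ()))
  ... | suc (suc k) = ⊥-elim (ℕP.<⇒≱ (s≤s (s≤s z≤n)) (begin
    2 ℕ.+ k                                   ≤⟨ ℕP.m≤m+n (2 ℕ.+ k) _ ⟩
    2 ℕ.+ k ℕ.+ ⟦ Q u ⟧ℕ                      ≡⟨ cong (ℕ._+ ⟦ Q u ⟧ℕ) eq ⟨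
    walkCount m w ℕ.+ ⟦ Q u ⟧ℕ                ≤⟨ count+end≤occurrences m Q C exits w ⟩
    occurrences Q (visited w)                 ≤⟨ occurrences-unique≤1 Q one (visited w) uniq ⟩
    1                                         ∎))
    where open ℕP.≤-Reasoning

-- The flow network of a partition

entryCondition? : ∀ b x → Dec (EntryCondition b x)
entryCondition? S0 x = x ℤP.≟ 0ℤ
entryCondition? S+ x = 0ℤ ℤP.≤? x
entryCondition? S- x = x ℤP.≤? 0ℤ
entryCondition? SF x = yes tt

bit-update : ∀ x F B → Bit x → F ≡ 0 ⊎ (F ≡ 1 × x ≡ 0ℤ) → B ≡ 0 ⊎ (B ≡ 1 × x ≡ 1ℤ) → Bit (x + (+ F - + B))
bit-update x   .0 .0 bit (inj₁ refl)          (inj₁ refl)          = subst Bit (sym (ℤP.+-identityʳ x)) bit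
bit-update .0ℤ .1 .0 _   (inj₂ (refl , refl)) (inj₁ refl)          = inj₂ refl
bit-update .1ℤ .0 .1 _   (inj₁ refl)          (inj₂ (refl , refl)) = inj₁ refl
bit-update x   .1 .1 _   (inj₂ (refl , x≡0))  (inj₂ (refl , x≡1))  = case trans (sym x≡0) x≡1 of λ ()

condition-update : ∀ {b} x F B → EntryCondition b x →
  F ≡ 0 ⊎ (F ≡ 1 × EntryCondition b (x + 1ℤ)) → B ≡ 0 ⊎ (B ≡ 1 × EntryCondition b (x + -1ℤ)) →
  EntryCondition b (x + (+ F - + B))
condition-update {b} x .0 .0 c (inj₁ refl)      (inj₁ refl)      = subst (EntryCondition b) (sym (ℤP.+-identityʳ x)) c
condition-update     x .1 .0 _ (inj₂ (refl , c)) (inj₁ refl)      = c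
condition-update     x .0 .1 _ (inj₁ refl)      (inj₂ (refl , c)) = c
condition-update {b} x .1 .1 c (inj₂ (refl , _)) (inj₂ (refl , _)) = subst (EntryCondition b) (sym (ℤP.+-identityʳ x)) c

module Network (n : ℕ) (P : Partition n) where

  data Layer : Set where
    horizontal vertical : Layer

  data Node : Set where
    src snk : Node
    cell    : Layer → Fin n → Fin n → Node

  pattern hN i j = cell horizontal i j
  pattern vN i j = cell vertical i j

  _≟L_ : DecidableEquality Layer
  horizontal ≟L horizontal = yes refl
  horizontal ≟L vertical   = no λ ()
  vertical   ≟L horizontal = no λ ()
  vertical   ≟L vertical   = yes refl

  _≟N_ : DecidableEquality Node
  src ≟N src = yes refl
  src ≟N snk = no λ ()
  src ≟N cell _ _ _ = no λ ()
  snk ≟N src = no λ ()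
  snk ≟N snk = yes refl
  snk ≟N cell _ _ _ = no λ ()
  cell _ _ _ ≟N src = no λ ()
  cell _ _ _ ≟N snk = no λ ()
  cell l i j ≟N cell l′ i′ j′ =
    map′ (λ { (refl , refl , refl) → refl }) (λ { refl → refl , refl , refl })
         (l ≟L l′ ×-dec i Fin.≟ i′ ×-dec j Fin.≟ j′)

  allNodes : List Node
  allNodes = src ∷ snk ∷ (cells horizontal ++ cells vertical)
    where cells : Layer → List Node
          cells l = cartesianProductWith (cell l) (allFin n) (allFin n)

  complete : ∀ u → u ∈ allNodes
  complete src      = here refl
  complete snk      = there (here refl)
  complete (hN i j) = there (there (∈-++⁺ˡ (∈-cartesianProductWith⁺ (cell horizontal) (∈-allFin i) (∈-allFin j))))
  complete (vN i j) = there (there (∈-++⁺ʳ _ (∈-cartesianProductWith⁺ (cell vertical) (∈-allFin i) (∈-allFin j))))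

  -- h r g is the flow entering cell (r, g) from the left (g = n: leaving row r on the right),
  -- v g c the flow entering cell (g, c) from above (g = n: leaving column c at the bottom);
  -- the matrix entry is the flow turning from horizontal to vertical in a cell.
  matrix : (ℕ → ℕ → ℤ) → Matrix n
  matrix h i = differences (h (toℕ i))

  record Flow (k : ℕ) : Set where
    field
      h v          : ℕ → ℕ → ℤ
      h-bit        : ∀ r g → Bit (h r g)
      v-bit        : ∀ g c → Bit (v g c)
      h-end        : ∀ r → h r n ≡ 0ℤ
      v-top        : ∀ c → v 0 c ≡ 0ℤ
      conservation : ∀ (i j : Fin n) → matrix h i j ≡ v (suc (toℕ i)) (toℕ j) - v (toℕ i) (toℕ j)
      condition    : ∀ (i j : Fin n) → EntryCondition (P (i , j)) (matrix h i j)
      h-value      : sumℤ (λ (i : Fin n) → h (toℕ i) 0) ≡ + k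
      v-value      : sumℤ (λ (j : Fin n) → v n (toℕ j)) ≡ + k

  module Residual (h v : ℕ → ℕ → ℤ) where

    data Arc : Node → Node → Set where
      source : ∀ {i j} → toℕ j ≡ 0 → h (toℕ i) 0 ≡ 0ℤ → Arc src (hN i j)
      right  : ∀ {i j j′} → suc (toℕ j) ≡ toℕ j′ → h (toℕ i) (toℕ j′) ≡ 0ℤ → Arc (hN i j) (hN i j′)
      left   : ∀ {i j j′} → suc (toℕ j) ≡ toℕ j′ → h (toℕ i) (toℕ j′) ≡ 1ℤ → Arc (hN i j′) (hN i j)
      turn   : ∀ {i j} → EntryCondition (P (i , j)) (matrix h i j + 1ℤ) → Arc (hN i j) (vN i j)
      unturn : ∀ {i j} → EntryCondition (P (i , j)) (matrix h i j - 1ℤ) → Arc (vN i j) (hN i j)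
      down   : ∀ {i i′ j} → suc (toℕ i) ≡ toℕ i′ → v (toℕ i′) (toℕ j) ≡ 0ℤ → Arc (vN i j) (vN i′ j)
      up     : ∀ {i i′ j} → suc (toℕ i) ≡ toℕ i′ → v (toℕ i′) (toℕ j) ≡ 1ℤ → Arc (vN i′ j) (vN i j)
      sink   : ∀ {i j} → suc (toℕ i) ≡ n → v n (toℕ j) ≡ 0ℤ → Arc (vN i j) snk

    arc? : ∀ a b → Dec (Arc a b)
    arc? src (hN i j) =
      map′ (uncurry source) (λ { (source e z) → e , z }) (toℕ j ℕ.≟ 0 ×-dec h (toℕ i) 0 ℤP.≟ 0ℤ)
    arc? (hN i j) (hN i′ j′) with i Fin.≟ i′
    ... | no i≢i′ = no λ { (right _ _) → i≢i′ refl ; (left _ _) → i≢i′ refl }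
    ... | yes refl =
      map′ [ uncurry right , uncurry left ] (λ { (right e z) → inj₁ (e , z) ; (left e o) → inj₂ (e , o) })
           ((suc (toℕ j) ℕ.≟ toℕ j′ ×-dec h (toℕ i) (toℕ j′) ℤP.≟ 0ℤ) ⊎-dec
            (suc (toℕ j′) ℕ.≟ toℕ j ×-dec h (toℕ i) (toℕ j) ℤP.≟ 1ℤ))
    arc? (hN i j) (vN i′ j′) with i Fin.≟ i′ | j Fin.≟ j′
    ... | no i≢i′ | _        = no λ { (turn _) → i≢i′ refl }
    ... | yes _   | no j≢j′  = no λ { (turn _) → j≢j′ refl }
    ... | yes refl | yes refl =
      map′ turn (λ { (turn c) → c }) (entryCondition? (P (i , j)) (matrix h i j + 1ℤ))
    arc? (vN i j) (hN i′ j′) with i Fin.≟ i′ | j Fin.≟ j′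
    ... | no i≢i′ | _        = no λ { (unturn _) → i≢i′ refl }
    ... | yes _   | no j≢j′  = no λ { (unturn _) → j≢j′ refl }
    ... | yes refl | yes refl =
      map′ unturn (λ { (unturn c) → c }) (entryCondition? (P (i , j)) (matrix h i j - 1ℤ))
    arc? (vN i j) (vN i′ j′) with j Fin.≟ j′
    ... | no j≢j′ = no λ { (down _ _) → j≢j′ refl ; (up _ _) → j≢j′ refl }
    ... | yes refl =
      map′ [ uncurry down , uncurry up ] (λ { (down e z) → inj₁ (e , z) ; (up e o) → inj₂ (e , o) })
           ((suc (toℕ i) ℕ.≟ toℕ i′ ×-dec v (toℕ i′) (toℕ j) ℤP.≟ 0ℤ) ⊎-dec
            (suc (toℕ i′) ℕ.≟ toℕ i ×-dec v (toℕ i) (toℕ j) ℤP.≟ 1ℤ))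
    arc? (vN i j) snk = map′ (uncurry sink) (λ { (sink e z) → e , z }) (suc (toℕ i) ℕ.≟ n ×-dec v n (toℕ j) ℤP.≟ 0ℤ)
    arc? src src      = no λ ()
    arc? src snk      = no λ ()
    arc? src (vN _ _) = no λ ()
    arc? snk _        = no λ ()
    arc? (hN _ _) src = no λ ()
    arc? (hN _ _) snk = no λ ()
    arc? (vN _ _) src = no λ ()

    module R = Reachability _≟N_ allNodes complete Arc arc? src snk
    open R public using (Walk; visited; Cut; Closed; ArcCount; ArcWeight; walkSum; walkCount; CountsExitsFrom; path-or-cut)

    -- The column is tested first: in the balance lemmas below it is the test that computes.
    at : ℕ → ℕ → Fin n → Fin n → Bool
    at r c i j = (c ≡ᵇ toℕ j) ∧ (r ≡ᵇ toℕ i)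

    isH isV : ℕ → ℕ → Node → Bool
    isH r c (hN i j) = at r c i j
    isH r c _        = false
    isV r c (vN i j) = at r c i j
    isV r c _        = false

    isSrc isSnk : Node → Bool
    isSrc src = true
    isSrc _   = false
    isSnk snk = true
    isSnk _   = false

    isLeftOf : ℕ → ℕ → Node → Bool
    isLeftOf r zero    = isSrc
    isLeftOf r (suc g) = isH r g

    isAbove : ℕ → ℕ → Node → Bool
    isAbove zero    c _ = false
    isAbove (suc g) c   = isV g c

    -- How often an arc crosses boundary (r, g) forwards or backwards, or turns in cell (r, c).
    fwH bwH fwV bwV turns unturns : ℕ → ℕ → ArcCount
    fwH r g (source {i} _ _)         = ⟦ (g ≡ᵇ 0) ∧ (r ≡ᵇ toℕ i) ⟧ℕ
    fwH r g (right {i} {j′ = j′} _ _) = ⟦ at r g i j′ ⟧ℕ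
    fwH r g _                        = 0
    bwH r g (left {i} {j′ = j′} _ _)  = ⟦ at r g i j′ ⟧ℕ
    bwH r g _                        = 0
    fwV g c (down {i′ = i′} {j} _ _)  = ⟦ at g c i′ j ⟧ℕ
    fwV g c (sink {i} {j} _ _)       = ⟦ (c ≡ᵇ toℕ j) ∧ (g ≡ᵇ suc (toℕ i)) ⟧ℕ
    fwV g c _                        = 0
    bwV g c (up {i′ = i′} {j} _ _)    = ⟦ at g c i′ j ⟧ℕ
    bwV g c _                        = 0
    turns r c (turn {i} {j} _)       = ⟦ at r c i j ⟧ℕ
    turns r c _                      = 0
    unturns r c (unturn {i} {j} _)   = ⟦ at r c i j ⟧ℕ
    unturns r c _                    = 0

    δh δv δA : ℕ → ℕ → ArcWeight
    δh r g x = + fwH r g x - + bwH r g x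
    δv g c x = + fwV g c x - + bwV g c x
    δA r c x = + turns r c x - + unturns r c x

    potential : (Node → Bool) → Node → ℤ
    potential Q u = + ⟦ Q u ⟧ℕ

    at-self : ∀ i j → at (toℕ i) (toℕ j) i j ≡ true
    at-self i j rewrite ≡ᵇ-refl (toℕ j) | ≡ᵇ-refl (toℕ i) = refl

    at-sound : ∀ r c i j → at r c i j ≡ true → r ≡ toℕ i × c ≡ toℕ j
    at-sound r c i j t = let c≡j , r≡i = ≡ᵇ∧≡ᵇ-sound c (toℕ j) r (toℕ i) t in r≡i , c≡j

    at-unique : ∀ r c i j i′ j′ → at r c i j ≡ true → at r c i′ j′ ≡ true → i ≡ i′ × j ≡ j′
    at-unique r c i j i′ j′ t t′ =
      FinP.toℕ-injective (trans (sym r≡i) r≡i′) , FinP.toℕ-injective (trans (sym c≡j) c≡j′)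
      where
      r≡i = proj₁ (at-sound r c i j t)
      c≡j = proj₂ (at-sound r c i j t)
      r≡i′ = proj₁ (at-sound r c i′ j′ t′)
      c≡j′ = proj₂ (at-sound r c i′ j′ t′)

    isH-one : ∀ r c → R.AtMostOne (isH r c)
    isH-one r c (hN i j) (hN i′ j′) t t′ with at-unique r c i j i′ j′ t t′
    ... | refl , refl = refl

    isV-one : ∀ r c → R.AtMostOne (isV r c)
    isV-one r c (vN i j) (vN i′ j′) t t′ with at-unique r c i j i′ j′ t t′
    ... | refl , refl = refl

    isLeftOf-one : ∀ r g → R.AtMostOne (isLeftOf r g)
    isLeftOf-one r zero    src src _ _ = refl
    isLeftOf-one r (suc g) = isH-one r g

    isAbove-one : ∀ g c → R.AtMostOne (isAbove g c)
    isAbove-one zero    c a b ()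
    isAbove-one (suc g) c = isV-one g c

    private
      exitIf : ∀ {Q C : Set} b → (b ≡ true → Q × C) → ⟦ b ⟧ℕ ≡ 0 ⊎ (⟦ b ⟧ℕ ≡ 1 × Q × C)
      exitIf false _   = inj₁ refl
      exitIf true  q×c = inj₂ (refl , q×c refl)

    fwH-exits : ∀ r g → CountsExitsFrom (fwH r g) (isLeftOf r g) (h r g ≡ 0ℤ)
    fwH-exits r g (source {i} _ h≡0) = exitIf ((g ≡ᵇ 0) ∧ (r ≡ᵇ toℕ i)) λ t →
      case ≡ᵇ∧≡ᵇ-sound g 0 r (toℕ i) t of λ { (refl , refl) → refl , h≡0 }
    fwH-exits r g (right {i} {j} {j′} j+1≡j′ h≡0) = exitIf (at r g i j′) λ t →
      case at-sound r g i j′ t of λ { (refl , refl) →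
        subst (λ m → isLeftOf (toℕ i) m (hN i j) ≡ true) j+1≡j′ (at-self i j) , h≡0 }
    fwH-exits r g (left _ _)   = inj₁ refl
    fwH-exits r g (turn _)     = inj₁ refl
    fwH-exits r g (unturn _)   = inj₁ refl
    fwH-exits r g (down _ _)   = inj₁ refl
    fwH-exits r g (up _ _)     = inj₁ refl
    fwH-exits r g (sink _ _)   = inj₁ refl

    bwH-exits : ∀ r g → CountsExitsFrom (bwH r g) (isH r g) (h r g ≡ 1ℤ)
    bwH-exits r g (left {i} {j′ = j′} _ h≡1) = exitIf (at r g i j′) λ t →
      case at-sound r g i j′ t of λ { (refl , refl) → at-self i j′ , h≡1 }
    bwH-exits r g (source _ _) = inj₁ refl
    bwH-exits r g (right _ _)  = inj₁ refl
    bwH-exits r g (turn _)     = inj₁ refl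
    bwH-exits r g (unturn _)   = inj₁ refl
    bwH-exits r g (down _ _)   = inj₁ refl
    bwH-exits r g (up _ _)     = inj₁ refl
    bwH-exits r g (sink _ _)   = inj₁ refl

    fwV-exits : ∀ g c → CountsExitsFrom (fwV g c) (isAbove g c) (v g c ≡ 0ℤ)
    fwV-exits g c (down {i} {i′} {j} i+1≡i′ v≡0) = exitIf (at g c i′ j) λ t →
      case at-sound g c i′ j t of λ { (refl , refl) →
        subst (λ m → isAbove m (toℕ j) (vN i j) ≡ true) i+1≡i′ (at-self i j) , v≡0 }
    fwV-exits g c (sink {i} {j} i+1≡n v≡0) = exitIf ((c ≡ᵇ toℕ j) ∧ (g ≡ᵇ suc (toℕ i))) λ t →
      case ≡ᵇ∧≡ᵇ-sound c (toℕ j) g (suc (toℕ i)) t of λ { (refl , refl) →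
        at-self i j , subst (λ m → v m (toℕ j) ≡ 0ℤ) (sym i+1≡n) v≡0 }
    fwV-exits g c (source _ _) = inj₁ refl
    fwV-exits g c (right _ _)  = inj₁ refl
    fwV-exits g c (left _ _)   = inj₁ refl
    fwV-exits g c (turn _)     = inj₁ refl
    fwV-exits g c (unturn _)   = inj₁ refl
    fwV-exits g c (up _ _)     = inj₁ refl

    bwV-exits : ∀ g c → CountsExitsFrom (bwV g c) (isV g c) (v g c ≡ 1ℤ)
    bwV-exits g c (up {i′ = i′} {j} _ v≡1) = exitIf (at g c i′ j) λ t →
      case at-sound g c i′ j t of λ { (refl , refl) → at-self i′ j , v≡1 }
    bwV-exits g c (source _ _) = inj₁ refl
    bwV-exits g c (right _ _)  = inj₁ refl
    bwV-exits g c (left _ _)   = inj₁ refl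
    bwV-exits g c (turn _)     = inj₁ refl
    bwV-exits g c (unturn _)   = inj₁ refl
    bwV-exits g c (down _ _)   = inj₁ refl
    bwV-exits g c (sink _ _)   = inj₁ refl

    ConditionAfter : ℤ → ℕ → ℕ → Set
    ConditionAfter d r c = ∀ (i j : Fin n) → toℕ i ≡ r → toℕ j ≡ c → EntryCondition (P (i , j)) (matrix h i j + d)

    turns-exits : ∀ r c → CountsExitsFrom (turns r c) (isH r c) (ConditionAfter 1ℤ r c)
    turns-exits r c (turn {i} {j} cond) = exitIf (at r c i j) λ t →
      case at-sound r c i j t of λ { (refl , refl) → at-self i j , λ { i′ j′ i′≡i j′≡j →
        case FinP.toℕ-injective i′≡i , FinP.toℕ-injective j′≡j of λ { (refl , refl) → cond } } }
    turns-exits r c (source _ _) = inj₁ refl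
    turns-exits r c (right _ _)  = inj₁ refl
    turns-exits r c (left _ _)   = inj₁ refl
    turns-exits r c (unturn _)   = inj₁ refl
    turns-exits r c (down _ _)   = inj₁ refl
    turns-exits r c (up _ _)     = inj₁ refl
    turns-exits r c (sink _ _)   = inj₁ refl

    unturns-exits : ∀ r c → CountsExitsFrom (unturns r c) (isV r c) (ConditionAfter -1ℤ r c)
    unturns-exits r c (unturn {i} {j} cond) = exitIf (at r c i j) λ t →
      case at-sound r c i j t of λ { (refl , refl) → at-self i j , λ { i′ j′ i′≡i j′≡j →
        case FinP.toℕ-injective i′≡i , FinP.toℕ-injective j′≡j of λ { (refl , refl) → cond } } }
    unturns-exits r c (source _ _) = inj₁ refl
    unturns-exits r c (right _ _)  = inj₁ refl
    unturns-exits r c (left _ _)   = inj₁ refl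
    unturns-exits r c (turn _)     = inj₁ refl
    unturns-exits r c (down _ _)   = inj₁ refl
    unturns-exits r c (up _ _)     = inj₁ refl
    unturns-exits r c (sink _ _)   = inj₁ refl

    private
      beyond-end : ∀ (j : Fin n) → (n ≡ᵇ toℕ j) ≡ false
      beyond-end j = ≢⇒≡ᵇ-false (λ n≡j → ℕP.<-irrefl (sym n≡j) (FinP.toℕ<n j))

      one-cell : ∀ (k : Fin n) → sumℤ (λ (i : Fin n) → + ⟦ toℕ i ≡ᵇ toℕ k ⟧ℕ - 0ℤ) ≡ 1ℤ
      one-cell k = trans (sum-single _ k off) (cong (λ b → + ⟦ b ⟧ℕ - 0ℤ) (≡ᵇ-refl (toℕ k)))
        where
        off : ∀ i → i ≢ k → + ⟦ toℕ i ≡ᵇ toℕ k ⟧ℕ - 0ℤ ≡ 0ℤ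
        off i i≢k = cong (λ b → + ⟦ b ⟧ℕ - 0ℤ) (≢⇒≡ᵇ-false (i≢k ∘ FinP.toℕ-injective))

    fwH-end : ∀ r {a b} (x : Arc a b) → fwH r n x ≡ 0
    fwH-end r (source {i} {j} j≡0 _) =
      cong (λ b → ⟦ b ∧ (r ≡ᵇ toℕ i) ⟧ℕ) (trans (cong (n ≡ᵇ_) (sym j≡0)) (beyond-end j))
    fwH-end r (right {i} {j′ = j′} _ _) = cong (λ b → ⟦ b ∧ (r ≡ᵇ toℕ i) ⟧ℕ) (beyond-end j′)
    fwH-end r (left _ _)   = refl
    fwH-end r (turn _)     = refl
    fwH-end r (unturn _)   = refl
    fwH-end r (down _ _)   = refl
    fwH-end r (up _ _)     = refl
    fwH-end r (sink _ _)   = refl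

    bwH-end : ∀ r {a b} (x : Arc a b) → bwH r n x ≡ 0
    bwH-end r (left {i} {j′ = j′} _ _) = cong (λ b → ⟦ b ∧ (r ≡ᵇ toℕ i) ⟧ℕ) (beyond-end j′)
    bwH-end r (source _ _) = refl
    bwH-end r (right _ _)  = refl
    bwH-end r (turn _)     = refl
    bwH-end r (unturn _)   = refl
    bwH-end r (down _ _)   = refl
    bwH-end r (up _ _)     = refl
    bwH-end r (sink _ _)   = refl

    fwV-top : ∀ c {a b} (x : Arc a b) → fwV 0 c x ≡ 0
    fwV-top c (down {j = j} i+1≡i′ _) rewrite sym i+1≡i′ = cong ⟦_⟧ℕ (BoolP.∧-zeroʳ (c ≡ᵇ toℕ j))
    fwV-top c (sink {j = j} _ _)    = cong ⟦_⟧ℕ (BoolP.∧-zeroʳ (c ≡ᵇ toℕ j))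
    fwV-top c (source _ _) = refl
    fwV-top c (right _ _)  = refl
    fwV-top c (left _ _)   = refl
    fwV-top c (turn _)     = refl
    fwV-top c (unturn _)   = refl
    fwV-top c (up _ _)     = refl

    bwV-top : ∀ c {a b} (x : Arc a b) → bwV 0 c x ≡ 0
    bwV-top c (up {j = j} i+1≡i′ _) rewrite sym i+1≡i′ = cong ⟦_⟧ℕ (BoolP.∧-zeroʳ (c ≡ᵇ toℕ j))
    bwV-top c (source _ _) = refl
    bwV-top c (right _ _)  = refl
    bwV-top c (left _ _)   = refl
    bwV-top c (turn _)     = refl
    bwV-top c (unturn _)   = refl
    bwV-top c (down _ _)   = refl
    bwV-top c (sink _ _)   = refl

    -- Flow conservation along a single arc: what enters a node is what leaves it, up to the
    -- potential of the node, which telescopes away along a path from src to snk.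
    h-balance : ∀ r g {a b} (x : Arc a b) →
      δh r g x - δh r (suc g) x ≡ δA r g x + (potential (isH r g) b - potential (isH r g) a)
    h-balance r g (source {i} j≡0 _) rewrite j≡0 = ring (+ ⟦ (g ≡ᵇ 0) ∧ (r ≡ᵇ toℕ i) ⟧ℕ)
      where
      ring : ∀ F → (F - 0ℤ) - (0ℤ - 0ℤ) ≡ (0ℤ - 0ℤ) + (F - 0ℤ)
      ring = solve-∀
    h-balance r g (right {i} {j} j+1≡j′ _) rewrite sym j+1≡j′ =
      ring (+ ⟦ (g ≡ᵇ suc (toℕ j)) ∧ (r ≡ᵇ toℕ i) ⟧ℕ) (+ ⟦ at r g i j ⟧ℕ)
      where
      ring : ∀ F₁ F₂ → (F₁ - 0ℤ) - (F₂ - 0ℤ) ≡ (0ℤ - 0ℤ) + (F₁ - F₂)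
      ring = solve-∀
    h-balance r g (left {i} {j} j+1≡j′ _) rewrite sym j+1≡j′ =
      ring (+ ⟦ (g ≡ᵇ suc (toℕ j)) ∧ (r ≡ᵇ toℕ i) ⟧ℕ) (+ ⟦ at r g i j ⟧ℕ)
      where
      ring : ∀ B₁ B₂ → (0ℤ - B₁) - (0ℤ - B₂) ≡ (0ℤ - 0ℤ) + (B₂ - B₁)
      ring = solve-∀
    h-balance r g (turn {i} {j} _) = ring (+ ⟦ at r g i j ⟧ℕ)
      where
      ring : ∀ M → (0ℤ - 0ℤ) - (0ℤ - 0ℤ) ≡ (M - 0ℤ) + (0ℤ - M)
      ring = solve-∀
    h-balance r g (unturn {i} {j} _) = ring (+ ⟦ at r g i j ⟧ℕ)
      where
      ring : ∀ M → (0ℤ - 0ℤ) - (0ℤ - 0ℤ) ≡ (0ℤ - M) + (M - 0ℤ)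
      ring = solve-∀
    h-balance r g (down _ _) = refl
    h-balance r g (up _ _)   = refl
    h-balance r g (sink _ _) = refl

    v-balance : ∀ r c {a b} (x : Arc a b) → r < n →
      (δv r c x - δv (suc r) c x) + δA r c x ≡ potential (isV r c) b - potential (isV r c) a
    v-balance r c (source _ _) _ = refl
    v-balance r c (right _ _)  _ = refl
    v-balance r c (left _ _)   _ = refl
    v-balance r c (turn {i} {j} _) _ = ring (+ ⟦ at r c i j ⟧ℕ)
      where
      ring : ∀ M → ((0ℤ - 0ℤ) - (0ℤ - 0ℤ)) + (M - 0ℤ) ≡ M - 0ℤ
      ring = solve-∀
    v-balance r c (unturn {i} {j} _) _ = ring (+ ⟦ at r c i j ⟧ℕ)
      where
      ring : ∀ M → ((0ℤ - 0ℤ) - (0ℤ - 0ℤ)) + (0ℤ - M) ≡ 0ℤ - M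
      ring = solve-∀
    v-balance r c (down {i} {j = j} i+1≡i′ _) _ rewrite sym i+1≡i′ =
      ring (+ ⟦ (c ≡ᵇ toℕ j) ∧ (r ≡ᵇ suc (toℕ i)) ⟧ℕ) (+ ⟦ at r c i j ⟧ℕ)
      where
      ring : ∀ F₁ F₂ → ((F₁ - 0ℤ) - (F₂ - 0ℤ)) + (0ℤ - 0ℤ) ≡ F₁ - F₂
      ring = solve-∀
    v-balance r c (up {i} {j = j} i+1≡i′ _) _ rewrite sym i+1≡i′ =
      ring (+ ⟦ (c ≡ᵇ toℕ j) ∧ (r ≡ᵇ suc (toℕ i)) ⟧ℕ) (+ ⟦ at r c i j ⟧ℕ)
      where
      ring : ∀ B₁ B₂ → ((0ℤ - B₁) - (0ℤ - B₂)) + (0ℤ - 0ℤ) ≡ B₂ - B₁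
      ring = solve-∀
    v-balance r c (sink {i} {j} i+1≡n _) r<n
      rewrite ≢⇒≡ᵇ-false (λ r≡i+1 → ℕP.<-irrefl (trans r≡i+1 i+1≡n) r<n) | BoolP.∧-zeroʳ (c ≡ᵇ toℕ j) =
      ring (+ ⟦ at r c i j ⟧ℕ)
      where
      ring : ∀ F → ((0ℤ - 0ℤ) - (F - 0ℤ)) + (0ℤ - 0ℤ) ≡ 0ℤ - F
      ring = solve-∀

    source-balance : ∀ {a b} (x : Arc a b) →
      sumℤ (λ (i : Fin n) → δh (toℕ i) 0 x) ≡ potential isSrc a - potential isSrc b
    source-balance (source {i} _ _)           = one-cell i
    source-balance (right {j = j} j+1≡j′ _) rewrite sym j+1≡j′ = sum-zero {n} (λ _ → refl)
    source-balance (left {j = j} j+1≡j′ _)  rewrite sym j+1≡j′ = sum-zero {n} (λ _ → refl)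
    source-balance (turn _)   = sum-zero {n} (λ _ → refl)
    source-balance (unturn _) = sum-zero {n} (λ _ → refl)
    source-balance (down _ _) = sum-zero {n} (λ _ → refl)
    source-balance (up _ _)   = sum-zero {n} (λ _ → refl)
    source-balance (sink _ _) = sum-zero {n} (λ _ → refl)

    sink-balance : ∀ {a b} (x : Arc a b) →
      sumℤ (λ (j : Fin n) → δv n (toℕ j) x) ≡ potential isSnk b - potential isSnk a
    sink-balance (down {i′ = i′} {j₀} _ _) rewrite beyond-end i′ =
      sum-zero {n} (λ j → cong (λ b → + ⟦ b ⟧ℕ - 0ℤ) (BoolP.∧-zeroʳ (toℕ j ≡ᵇ toℕ j₀)))
    sink-balance (up {i′ = i′} {j₀} _ _) rewrite beyond-end i′ =
      sum-zero {n} (λ j → cong (λ b → 0ℤ - + ⟦ b ⟧ℕ) (BoolP.∧-zeroʳ (toℕ j ≡ᵇ toℕ j₀)))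
    sink-balance (sink {i₀} {j₀} i+1≡n _) rewrite dec-true (n ℕP.≟ suc (toℕ i₀)) (sym i+1≡n) =
      trans (sum-cong {n} (λ j → cong (λ b → + ⟦ b ⟧ℕ - 0ℤ) (BoolP.∧-identityʳ (toℕ j ≡ᵇ toℕ j₀)))) (one-cell j₀)
    sink-balance (source _ _) = sum-zero {n} (λ _ → refl)
    sink-balance (right _ _)  = sum-zero {n} (λ _ → refl)
    sink-balance (left _ _)   = sum-zero {n} (λ _ → refl)
    sink-balance (turn _)     = sum-zero {n} (λ _ → refl)
    sink-balance (unturn _)   = sum-zero {n} (λ _ → refl)

  module Augment {k : ℕ} (flow : Flow k) where
    open Flow flow
    open Residual h v

    module _ (w : Walk snk) (simple : Unique (visited w)) where

      h′ v′ : ℕ → ℕ → ℤ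
      h′ r g = h r g + walkSum (δh r g) w
      v′ g c = v g c + walkSum (δv g c) w

      ΔA : ℕ → ℕ → ℤ
      ΔA r c = walkSum (δA r c) w

      private
        crossings : ∀ (fw bw : ArcCount) → walkSum (λ x → + fw x - + bw x) w ≡ + walkCount fw w - + walkCount bw w
        crossings fw bw = trans (R.walkSum-distrib-- (λ x → + fw x) (λ x → + bw x) w)
                                (cong₂ _-_ (R.walkSum-count fw w) (R.walkSum-count bw w))

        -- A simple path crosses each boundary, and turns in each cell, at most once each way.
        once : ∀ (m : ArcCount) {Q C} → R.AtMostOne Q → CountsExitsFrom m Q C →
          walkCount m w ≡ 0 ⊎ (walkCount m w ≡ 1 × C)
        once m one exits = R.simpleWalk-count≤1 m _ _ one exits w simple

      h′-bit : ∀ r g → Bit (h′ r g)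
      h′-bit r g = subst Bit (cong (_+_ (h r g)) (sym (crossings (fwH r g) (bwH r g))))
        (bit-update (h r g) _ _ (h-bit r g) (once (fwH r g) (isLeftOf-one r g) (fwH-exits r g))
                                            (once (bwH r g) (isH-one r g) (bwH-exits r g)))

      v′-bit : ∀ g c → Bit (v′ g c)
      v′-bit g c = subst Bit (cong (_+_ (v g c)) (sym (crossings (fwV g c) (bwV g c))))
        (bit-update (v g c) _ _ (v-bit g c) (once (fwV g c) (isAbove-one g c) (fwV-exits g c))
                                            (once (bwV g c) (isV-one g c) (bwV-exits g c)))

      h′-end : ∀ r → h′ r n ≡ 0ℤ
      h′-end r rewrite crossings (fwH r n) (bwH r n) | R.walkCount-zero (fwH r n) (fwH-end r) w
                     | R.walkCount-zero (bwH r n) (bwH-end r) w | h-end r = refl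

      v′-top : ∀ c → v′ 0 c ≡ 0ℤ
      v′-top c rewrite crossings (fwV 0 c) (bwV 0 c) | R.walkCount-zero (fwV 0 c) (fwV-top c) w
                     | R.walkCount-zero (bwV 0 c) (bwV-top c) w | v-top c = refl

      h-step : ∀ r g → walkSum (δh r g) w - walkSum (δh r (suc g)) w ≡ ΔA r g
      h-step r g = begin
        walkSum (δh r g) w - walkSum (δh r (suc g)) w
          ≡⟨ R.walkSum-distrib-- (δh r g) (δh r (suc g)) w ⟨
        walkSum (λ x → δh r g x - δh r (suc g) x) w
          ≡⟨ R.walkSum-cong (h-balance r g) w ⟩
        walkSum (λ {a} {b} x → δA r g x + (potential (isH r g) b - potential (isH r g) a)) w
          ≡⟨ R.walkSum-distrib-+ (δA r g) (λ {a} {b} _ → potential (isH r g) b - potential (isH r g) a) w ⟩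
        ΔA r g + walkSum (λ {a} {b} _ → potential (isH r g) b - potential (isH r g) a) w
          ≡⟨ cong (_+_ (ΔA r g)) (R.walkSum-telescope (potential (isH r g)) w) ⟩
        ΔA r g + 0ℤ
          ≡⟨ ℤP.+-identityʳ (ΔA r g) ⟩
        ΔA r g ∎
        where open ≡-Reasoning

      v-step : ∀ r c → r < n → walkSum (δv (suc r) c) w - walkSum (δv r c) w ≡ ΔA r c
      v-step r c r<n = begin
        Y - X               ≡⟨ ring X Y (ΔA r c) ⟩
        ΔA r c - ((X - Y) + ΔA r c) ≡⟨ cong (_-_ (ΔA r c)) balance ⟩
        ΔA r c - 0ℤ         ≡⟨ ℤP.+-identityʳ (ΔA r c) ⟩
        ΔA r c              ∎
        where
        open ≡-Reasoning
        X = walkSum (δv r c) w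
        Y = walkSum (δv (suc r) c) w
        ring : ∀ X Y D → Y - X ≡ D - ((X - Y) + D)
        ring = solve-∀
        balance : (X - Y) + ΔA r c ≡ 0ℤ
        balance = begin
          (X - Y) + ΔA r c
            ≡⟨ cong (_+ ΔA r c) (R.walkSum-distrib-- (δv r c) (δv (suc r) c) w) ⟨
          walkSum (λ x → δv r c x - δv (suc r) c x) w + ΔA r c
            ≡⟨ R.walkSum-distrib-+ (λ x → δv r c x - δv (suc r) c x) (δA r c) w ⟨
          walkSum (λ x → (δv r c x - δv (suc r) c x) + δA r c x) w
            ≡⟨ R.walkSum-cong (λ x → v-balance r c x r<n) w ⟩
          walkSum (λ {a} {b} _ → potential (isV r c) b - potential (isV r c) a) w
            ≡⟨ R.walkSum-telescope (potential (isV r c)) w ⟩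
          0ℤ ∎

      matrix-h′ : ∀ i j → matrix h′ i j ≡ matrix h i j + ΔA (toℕ i) (toℕ j)
      matrix-h′ i j = trans (interchange (h r c) (h r (suc c)) (walkSum (δh r c) w) (walkSum (δh r (suc c)) w))
                            (cong (_+_ (matrix h i j)) (h-step r c))
        where
        r = toℕ i
        c = toℕ j
        interchange : ∀ (a b c d : ℤ) → (a + c) - (b + d) ≡ (a - b) + (c - d)
        interchange = solve-∀

      conservation′ : ∀ i j → matrix h′ i j ≡ v′ (suc (toℕ i)) (toℕ j) - v′ (toℕ i) (toℕ j)
      conservation′ i j = begin
        matrix h′ i j                   ≡⟨ matrix-h′ i j ⟩
        matrix h i j + ΔA r c           ≡⟨ cong₂ _+_ (conservation i j) (sym (v-step r c (FinP.toℕ<n i))) ⟩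
        (v (suc r) c - v r c) + (walkSum (δv (suc r) c) w - walkSum (δv r c) w)
                                        ≡⟨ interchange (v (suc r) c) (v r c) (walkSum (δv (suc r) c) w) (walkSum (δv r c) w) ⟨
        v′ (suc r) c - v′ r c           ∎
        where
        open ≡-Reasoning
        r = toℕ i
        c = toℕ j
        interchange : ∀ (a b c d : ℤ) → (a + c) - (b + d) ≡ (a - b) + (c - d)
        interchange = solve-∀

      condition′ : ∀ i j → EntryCondition (P (i , j)) (matrix h′ i j)
      condition′ i j =
        subst (EntryCondition (P (i , j)))
              (sym (trans (matrix-h′ i j) (cong (_+_ (matrix h i j)) (crossings (turns r c) (unturns r c)))))
          (condition-update (matrix h i j) _ _ (condition i j)
            (atCell (once (turns r c) (isH-one r c) (turns-exits r c)))
            (atCell (once (unturns r c) (isV-one r c) (unturns-exits r c))))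
        where
        r = toℕ i
        c = toℕ j
        atCell : ∀ {F d} → F ≡ 0 ⊎ (F ≡ 1 × ConditionAfter d r c) →
          F ≡ 0 ⊎ (F ≡ 1 × EntryCondition (P (i , j)) (matrix h i j + d))
        atCell (inj₁ F≡0)       = inj₁ F≡0
        atCell (inj₂ (F≡1 , c)) = inj₂ (F≡1 , c i j refl refl)

      h′-value : sumℤ (λ (i : Fin n) → h′ (toℕ i) 0) ≡ + suc k
      h′-value = begin
        sumℤ (λ (i : Fin n) → h′ (toℕ i) 0)
          ≡⟨ sum-distrib-+ {n} (λ i → h (toℕ i) 0) (λ i → walkSum (δh (toℕ i) 0) w) ⟩
        sumℤ (λ (i : Fin n) → h (toℕ i) 0) + sumℤ (λ (i : Fin n) → walkSum (δh (toℕ i) 0) w)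
          ≡⟨ cong₂ _+_ h-value (R.walkSum-sum {n} (λ i → δh (toℕ i) 0) w) ⟩
        + k + walkSum (λ x → sumℤ (λ (i : Fin n) → δh (toℕ i) 0 x)) w
          ≡⟨ cong (_+_ (+ k)) (R.walkSum-cong (λ {a} {b} x →
               trans (source-balance x) (ring (potential isSrc a) (potential isSrc b))) w) ⟩
        + k + walkSum (λ {a} {b} _ → (- potential isSrc b) - (- potential isSrc a)) w
          ≡⟨ cong (_+_ (+ k)) (R.walkSum-telescope (λ u → - potential isSrc u) w) ⟩
        + k + 1ℤ
          ≡⟨ cong +_ (ℕP.+-comm k 1) ⟩
        + suc k ∎
        where
        open ≡-Reasoning
        ring : ∀ (p q : ℤ) → p - q ≡ (- q) - (- p)
        ring = solve-∀

      v′-value : sumℤ (λ (j : Fin n) → v′ n (toℕ j)) ≡ + suc k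
      v′-value = begin
        sumℤ (λ (j : Fin n) → v′ n (toℕ j))
          ≡⟨ sum-distrib-+ {n} (λ j → v n (toℕ j)) (λ j → walkSum (δv n (toℕ j)) w) ⟩
        sumℤ (λ (j : Fin n) → v n (toℕ j)) + sumℤ (λ (j : Fin n) → walkSum (δv n (toℕ j)) w)
          ≡⟨ cong₂ _+_ v-value (R.walkSum-sum {n} (λ j → δv n (toℕ j)) w) ⟩
        + k + walkSum (λ x → sumℤ (λ (j : Fin n) → δv n (toℕ j) x)) w
          ≡⟨ cong (_+_ (+ k)) (R.walkSum-cong sink-balance w) ⟩
        + k + walkSum (λ {a} {b} _ → potential isSnk b - potential isSnk a) w
          ≡⟨ cong (_+_ (+ k)) (R.walkSum-telescope (potential isSnk) w) ⟩
        + k + 1ℤ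
          ≡⟨ cong +_ (ℕP.+-comm k 1) ⟩
        + suc k ∎
        where open ≡-Reasoning

      augment : Flow (suc k)
      augment = record
        { h = h′ ; v = v′ ; h-bit = h′-bit ; v-bit = v′-bit ; h-end = h′-end ; v-top = v′-top
        ; conservation = conservation′ ; condition = condition′ ; h-value = h′-value ; v-value = v′-value }

  zeroFlow : Flow 0
  zeroFlow = record
    { h = λ _ _ → 0ℤ ; v = λ _ _ → 0ℤ ; h-bit = λ _ _ → inj₁ refl ; v-bit = λ _ _ → inj₁ refl
    ; h-end = λ _ → refl ; v-top = λ _ → refl ; conservation = λ _ _ → refl ; condition = zero-condition
    ; h-value = sum-zero {n} (λ _ → refl) ; v-value = sum-zero {n} (λ _ → refl) }
    where
    zero-condition : ∀ (i j : Fin n) → EntryCondition (P (i , j)) 0ℤ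
    zero-condition i j with P (i , j)
    ... | S0 = refl
    ... | S+ = ℤP.≤-refl
    ... | S- = ℤP.≤-refl
    ... | SF = tt

  FlowWithCut : ℕ → Set
  FlowWithCut k = Σ (Flow k) λ flow → Residual.Cut (Flow.h flow) (Flow.v flow)

  flow-or-cut : ∀ k → k ≤ n → Flow k ⊎ ∃ λ k′ → k′ < n × FlowWithCut k′
  flow-or-cut zero    _     = inj₁ zeroFlow
  flow-or-cut (suc k) k<n with flow-or-cut k (ℕP.<⇒≤ k<n)
  ... | inj₂ cut  = inj₂ cut
  ... | inj₁ flow with Residual.path-or-cut (Flow.h flow) (Flow.v flow)
  ...   | inj₁ (w , simple) = inj₁ (Augment.augment flow w simple)
  ...   | inj₂ cut          = inj₂ (k , k<n , flow , cut)

-- From a flow of value n to an alternating sign matrix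

module _ {n : ℕ} (P : Partition n) where
  open Network n P

  flow⇒asm : Flow n → ∃ λ (A : Matrix n) → IsASM A × Respects P A
  flow⇒asm flow = matrix h , asm , entryCondition⇒respects P condition
    where
    open Flow flow

    h-start : ∀ (i : Fin n) → h (toℕ i) 0 ≡ 1ℤ
    h-start = bits-full (λ i → h (toℕ i) 0) (λ _ → h-bit _ _) h-value

    v-bottom : ∀ (j : Fin n) → v n (toℕ j) ≡ 1ℤ
    v-bottom = bits-full (λ j → v n (toℕ j)) (λ _ → v-bit _ _) v-value

    column : ∀ j i → matrix h i j ≡ - differences (λ r → v r (toℕ j)) i
    column j i = trans (conservation i j) (ring (v (toℕ i) (toℕ j)) (v (suc (toℕ i)) (toℕ j)))
      where
      ring : ∀ a b → b - a ≡ - (a - b)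
      ring = solve-∀

    row-sum : ∀ i → sumℤ (matrix h i) ≡ 1ℤ
    row-sum i rewrite sum-telescope n (h (toℕ i)) | h-start i | h-end (toℕ i) = refl

    column-sum : ∀ j → sumℤ (λ i → matrix h i j) ≡ 1ℤ
    column-sum j = begin
      sumℤ (λ i → matrix h i j)                  ≡⟨ sum-cong (λ i → trans (column j i) (ring (v (toℕ i) c) (v (suc (toℕ i)) c))) ⟩
      sumℤ (differences {n} (λ r → - v r c))     ≡⟨ sum-telescope n (λ r → - v r c) ⟩
      - v 0 c - - v n c                          ≡⟨ cong₂ (λ a b → - a - - b) (v-top c) (v-bottom j) ⟩
      1ℤ                                         ∎
      where
      open ≡-Reasoning
      c = toℕ j
      ring : ∀ a b → - (a - b) ≡ (- a) - (- b)
      ring = solve-∀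

    asm : IsASM (matrix h)
    asm = record
      { entries = λ i j → bit-difference (h-bit _ _) (h-bit _ _)
      ; rowSum  = row-sum
      ; colSum  = column-sum
      ; rowAlt  = λ i → alternates-differences (h (toℕ i)) (h-bit (toℕ i))
      ; colAlt  = λ j → alternates-cong (column j)
                          (alternates-neg (alternates-differences (λ r → v r (toℕ j)) (λ r → v-bit r (toℕ j))))
      }

-- Maximal runs of a Boolean sequence

record Interval (n : ℕ) : Set where
  constructor interval
  field
    lo hi : Fin n
    lo≤hi : lo Fin.≤ hi

inside : ∀ {n} → ℕ → Interval n → Bool
inside c (interval lo hi _) = (toℕ lo ℕ.≤ᵇ c) ∧ (c ℕ.≤ᵇ toℕ hi)

coverCount : ∀ {n} → List (Interval n) → ℕ → ℤ
coverCount = countℤ (λ I c → ⟦ inside c I ⟧)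

module Runs (n : ℕ) (b : ℕ → Bool) (b-beyond : ∀ g → n ≤ g → b g ≡ false) where

  previous : ℕ → Bool
  previous zero    = false
  previous (suc g) = b g

  starts : ℕ → Bool
  starts g = not (previous g) ∧ b g

  extend : ℕ → ℕ → ℕ
  extend zero       g = g
  extend (suc fuel) g = if b (suc g) then extend fuel (suc g) else g

  ≤-extend : ∀ fuel g → g ≤ extend fuel g
  ≤-extend zero       g = ℕP.≤-refl
  ≤-extend (suc fuel) g with b (suc g)
  ... | true  = ℕP.≤-trans (ℕP.n≤1+n g) (≤-extend fuel (suc g))
  ... | false = ℕP.≤-refl

  extend-inside : ∀ fuel g → b g ≡ true → ∀ l → g ≤ l → l ≤ extend fuel g → b l ≡ true
  extend-inside zero       g bg l g≤l l≤g = subst (λ m → b m ≡ true) (ℕP.≤-antisym g≤l l≤g) bg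
  extend-inside (suc fuel) g bg l g≤l l≤e with b (suc g) in b[g+1]
  ... | false = subst (λ m → b m ≡ true) (ℕP.≤-antisym g≤l l≤e) bg
  ... | true with ℕP.m≤n⇒m<n∨m≡n g≤l
  ...   | inj₁ g<l  = extend-inside fuel (suc g) b[g+1] l g<l l≤e
  ...   | inj₂ refl = bg

  extend-stops : ∀ fuel g → n ≤ suc g ℕ.+ fuel → b (suc (extend fuel g)) ≡ false
  extend-stops zero       g n≤ = b-beyond (suc g) (subst (n ≤_) (ℕP.+-identityʳ (suc g)) n≤)
  extend-stops (suc fuel) g n≤ with b (suc g) in b[g+1]
  ... | false = b[g+1]
  ... | true  = extend-stops fuel (suc g) (subst (n ≤_) (ℕP.+-suc (suc g) fuel) n≤)

  runEnd : ℕ → ℕ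
  runEnd = extend n

  runEnd-stops : ∀ g → b (suc (runEnd g)) ≡ false
  runEnd-stops g = extend-stops n g (ℕP.≤-trans (ℕP.m≤n+m n g) (ℕP.n≤1+n (g ℕ.+ n)))

  true⇒<n : ∀ {g} → b g ≡ true → g < n
  true⇒<n {g} bg with g ℕ.<? n
  ... | yes g<n = g<n
  ... | no  g≮n = case trans (sym bg) (b-beyond g (ℕP.≮⇒≥ g≮n)) of λ ()

  runEnd<n : ∀ {g} → b g ≡ true → runEnd g < n
  runEnd<n {g} bg = true⇒<n (extend-inside n g bg (runEnd g) (≤-extend n g) ℕP.≤-refl)

  starts⇒true : ∀ g → starts g ≡ true → b g ≡ true
  starts⇒true g st with b g
  ... | true  = refl
  ... | false = trans (sym (BoolP.∧-zeroʳ (not (previous g)))) st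

  starts⇒previous-false : ∀ g → starts (suc g) ≡ true → b g ≡ false
  starts⇒previous-false g st with b g
  ... | false = refl
  ... | true  = case st of λ ()

  covers : ℕ → ℕ → ℤ
  covers g c = ⟦ starts g ∧ ((g ℕ.≤ᵇ c) ∧ (c ℕ.≤ᵇ runEnd g)) ⟧

  covers-before : ∀ c g → c < g → covers g c ≡ 0ℤ
  covers-before c g c<g rewrite ≰⇒≤ᵇ {g} {c} (ℕP.<⇒≱ c<g) = cong ⟦_⟧ (BoolP.∧-zeroʳ (starts g))

  covers-self : ∀ c → covers c c ≡ ⟦ starts c ⟧
  covers-self c with starts c in st
  ... | false = refl
  ... | true rewrite ≤⇒≤ᵇ (ℕP.≤-refl {c}) | ≤⇒≤ᵇ (≤-extend n c) = refl

  covers-gap : ∀ c → b (suc c) ≡ false → ∀ g → g < suc c → covers g (suc c) ≡ 0ℤ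
  covers-gap c gap g g≤c with starts g in st
  ... | false = refl
  ... | true with suc c ℕ.≤ᵇ runEnd g in c<end
  ...   | false = cong ⟦_⟧ (BoolP.∧-zeroʳ (g ℕ.≤ᵇ suc c))
  ...   | true  = case trans (sym gap) (extend-inside n g (starts⇒true g st) (suc c) (ℕP.<⇒≤ g≤c) (≤ᵇ⇒≤ c<end)) of λ ()

  covers-continue : ∀ c → b (suc c) ≡ true → ∀ g → g < suc c → covers g (suc c) ≡ covers g c
  covers-continue c on g g≤c with starts g
  ... | false = refl
  ... | true rewrite ≤⇒≤ᵇ {g} {suc c} (ℕP.<⇒≤ g≤c) | ≤⇒≤ᵇ {g} {c} (ℕP.m<1+n⇒m≤n g≤c) =
    cong ⟦_⟧ c+1≤end≡c≤end
    where
    c+1≤end≡c≤end : (suc c ℕ.≤ᵇ runEnd g) ≡ (c ℕ.≤ᵇ runEnd g)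
    c+1≤end≡c≤end with c ℕ.≤? runEnd g
    ... | no c≰end = trans (≰⇒≤ᵇ (c≰end ∘ ℕP.<⇒≤)) (sym (≰⇒≤ᵇ c≰end))
    ... | yes c≤end with ℕP.m≤n⇒m<n∨m≡n c≤end
    ...   | inj₁ c<end  = trans (≤⇒≤ᵇ c<end) (sym (≤⇒≤ᵇ c≤end))
    ...   | inj₂ c≡end = case trans (sym on) (subst (λ m → b (suc m) ≡ false) (sym c≡end) (runEnd-stops g)) of λ ()

  -- Each true position is covered by exactly one run: the one that started last.
  coverage-upto : ∀ c → sumUpTo (suc c) (λ g → covers g c) ≡ ⟦ b c ⟧
  coverage-upto zero    = trans (ℤP.+-identityˡ _) (covers-self 0)
  coverage-upto (suc c) = next (b (suc c)) refl
    where
    open ≡-Reasoning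
    next : ∀ x → b (suc c) ≡ x → sumUpTo (suc (suc c)) (λ g → covers g (suc c)) ≡ ⟦ b (suc c) ⟧
    next false b[c+1] = begin
      sumUpTo (suc c) (λ g → covers g (suc c)) + covers (suc c) (suc c)
        ≡⟨ cong₂ _+_ (sumUpTo-zero (suc c) (covers-gap c b[c+1])) (covers-self (suc c)) ⟩
      0ℤ + ⟦ not (b c) ∧ b (suc c) ⟧    ≡⟨ cong (λ x → 0ℤ + ⟦ not (b c) ∧ x ⟧) b[c+1] ⟩
      0ℤ + ⟦ not (b c) ∧ false ⟧        ≡⟨ cong (λ x → 0ℤ + ⟦ x ⟧) (BoolP.∧-zeroʳ (not (b c))) ⟩
      0ℤ                                ≡⟨ cong ⟦_⟧ b[c+1] ⟨
      ⟦ b (suc c) ⟧                     ∎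
    next true b[c+1] = begin
      sumUpTo (suc c) (λ g → covers g (suc c)) + covers (suc c) (suc c)
        ≡⟨ cong₂ _+_ (trans (sumUpTo-cong (suc c) (covers-continue c b[c+1])) (coverage-upto c)) (covers-self (suc c)) ⟩
      ⟦ b c ⟧ + ⟦ not (b c) ∧ b (suc c) ⟧ ≡⟨ cong (λ x → ⟦ b c ⟧ + ⟦ not (b c) ∧ x ⟧) b[c+1] ⟩
      ⟦ b c ⟧ + ⟦ not (b c) ∧ true ⟧      ≡⟨ either (b c) ⟩
      1ℤ                                  ≡⟨ cong ⟦_⟧ b[c+1] ⟨
      ⟦ b (suc c) ⟧                       ∎
      where
      either : ∀ x → ⟦ x ⟧ + ⟦ not x ∧ true ⟧ ≡ 1ℤ
      either true  = refl
      either false = refl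

  coverage : ∀ c → c < n → sumUpTo n (λ g → covers g c) ≡ ⟦ b c ⟧
  coverage c c<n = begin
    sumUpTo n (λ g → covers g c)                       ≡⟨ cong (λ m → sumUpTo m (λ g → covers g c)) (ℕP.m+[n∸m]≡n c<n) ⟨
    sumUpTo (suc c ℕ.+ (n ℕ.∸ suc c)) (λ g → covers g c) ≡⟨ sumUpTo-beyond (suc c) (n ℕ.∸ suc c) (covers-before c) ⟩
    sumUpTo (suc c) (λ g → covers g c)                 ≡⟨ coverage-upto c ⟩
    ⟦ b c ⟧                                            ∎
    where open ≡-Reasoning

  run : ∀ g → starts g ≡ true → Interval n
  run g st = interval (fromℕ< g<n) (fromℕ< end<n) lo≤hi
    where
    g<n = true⇒<n (starts⇒true g st)
    end<n = runEnd<n (starts⇒true g st)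
    lo≤hi : fromℕ< g<n Fin.≤ fromℕ< end<n
    lo≤hi rewrite FinP.toℕ-fromℕ< g<n | FinP.toℕ-fromℕ< end<n = ≤-extend n g

  -- The equation is kept so that run receives the proof that g starts a run.
  consRun : ∀ g x → starts g ≡ x → List (Interval n) → List (Interval n)
  consRun g true  st Is = run g st ∷ Is
  consRun g false _  Is = Is

  runsUpTo : ℕ → List (Interval n)
  runsUpTo zero    = []
  runsUpTo (suc m) = consRun m (starts m) refl (runsUpTo m)

  runs : List (Interval n)
  runs = runsUpTo n

  coverCount-runsUpTo : ∀ m c → coverCount (runsUpTo m) c ≡ sumUpTo m (λ g → covers g c)
  coverCount-runsUpTo zero    c = refl
  coverCount-runsUpTo (suc m) c =
    trans (consRun-count (starts m) refl) (trans (ℤP.+-comm (covers m c) _) (cong (_+ covers m c) (coverCount-runsUpTo m c)))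
    where
    consRun-count : ∀ x (st : starts m ≡ x) →
      coverCount (consRun m x st (runsUpTo m)) c ≡ ⟦ x ∧ ((m ℕ.≤ᵇ c) ∧ (c ℕ.≤ᵇ runEnd m)) ⟧ + coverCount (runsUpTo m) c
    consRun-count true st rewrite FinP.toℕ-fromℕ< (true⇒<n (starts⇒true m st))
                                | FinP.toℕ-fromℕ< (runEnd<n (starts⇒true m st)) = refl
    consRun-count false _ = sym (ℤP.+-identityˡ _)

  coverCount-runs : ∀ c → c < n → coverCount runs c ≡ ⟦ b c ⟧
  coverCount-runs c c<n = trans (coverCount-runsUpTo n c) (coverage c c<n)

  length-runsUpTo : ∀ m → + length (runsUpTo m) ≡ sumUpTo m (λ g → ⟦ starts g ⟧)
  length-runsUpTo zero    = refl
  length-runsUpTo (suc m) =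
    trans (consRun-length (starts m) refl) (trans (ℤP.+-comm ⟦ starts m ⟧ _) (cong (_+ ⟦ starts m ⟧) (length-runsUpTo m)))
    where
    consRun-length : ∀ x (st : starts m ≡ x) → + length (consRun m x st (runsUpTo m)) ≡ ⟦ x ⟧ + + length (runsUpTo m)
    consRun-length true  _ = refl
    consRun-length false _ = sym (ℤP.+-identityˡ _)

  record Maximal (I : Interval n) : Set where
    field
      left-end  : toℕ (Interval.lo I) ≡ 0 ⊎ ∃ λ p → toℕ (Interval.lo I) ≡ suc p × b p ≡ false
      right-end : b (suc (toℕ (Interval.hi I))) ≡ false

  runs-maximal : All Maximal runs
  runs-maximal = upTo n
    where
    left : ∀ g → starts g ≡ true → g ≡ 0 ⊎ ∃ λ p → g ≡ suc p × b p ≡ false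
    left zero    _  = inj₁ refl
    left (suc p) st = inj₂ (p , refl , starts⇒previous-false p st)
    maximal : ∀ g st → Maximal (run g st)
    maximal g st = record
      { left-end  = subst (λ l → l ≡ 0 ⊎ ∃ λ p → l ≡ suc p × b p ≡ false)
                          (sym (FinP.toℕ-fromℕ< (true⇒<n (starts⇒true g st)))) (left g st)
      ; right-end = subst (λ l → b (suc l) ≡ false)
                          (sym (FinP.toℕ-fromℕ< (runEnd<n (starts⇒true g st)))) (runEnd-stops g) }
    upTo : ∀ m → All Maximal (runsUpTo m)
    upTo zero    = []
    upTo (suc m) = consRun-maximal m (starts m) refl (upTo m)
      where
      consRun-maximal : ∀ g x (st : starts g ≡ x) {Is} → All Maximal Is → All Maximal (consRun g x st Is)
      consRun-maximal g true  st maximals = maximal g st ∷ maximals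
      consRun-maximal g false _  maximals = maximals

pad : ∀ {n} → (Fin n → Bool) → ℕ → Bool
pad {n} f g with g ℕ.<? n
... | yes g<n = f (fromℕ< g<n)
... | no  _   = false

pad-< : ∀ {n} (f : Fin n → Bool) g (g<n : g < n) → pad f g ≡ f (fromℕ< g<n)
pad-< {n} f g g<n with g ℕ.<? n
... | yes _   = refl
... | no  g≮n = ⊥-elim (g≮n g<n)

pad-toℕ : ∀ {n} (f : Fin n → Bool) j → pad f (toℕ j) ≡ f j
pad-toℕ f j = trans (pad-< f (toℕ j) (FinP.toℕ<n j)) (cong f (FinP.fromℕ<-toℕ j (FinP.toℕ<n j)))

pad-beyond : ∀ {n} (f : Fin n → Bool) g → n ≤ g → pad f g ≡ false
pad-beyond {n} f g n≤g with g ℕ.<? n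
... | yes g<n = ⊥-elim (ℕP.<⇒≱ g<n n≤g)
... | no  _   = refl

pad-not : ∀ {n} (f : Fin n → Bool) g → g < n → pad (λ j → not (f j)) g ≡ not (pad f g)
pad-not f g g<n = trans (pad-< _ g g<n) (cong not (sym (pad-< f g g<n)))

consecutive : ∀ {n g} (g<n : g < n) (g+1<n : suc g < n) → suc (toℕ (fromℕ< g<n)) ≡ toℕ (fromℕ< g+1<n)
consecutive g<n g+1<n = trans (cong suc (FinP.toℕ-fromℕ< g<n)) (sym (FinP.toℕ-fromℕ< g+1<n))

module _ {n : ℕ} {S : Set} {_∈ₛ_ : Pos n → S → Set} (_∈ₛ?_ : ∀ p s → Dec (p ∈ₛ s)) where

  coverBy-++ : ∀ xs ys p → coverBy _∈ₛ?_ (xs ++ ys) p ≡ coverBy _∈ₛ?_ xs p + coverBy _∈ₛ?_ ys p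
  coverBy-++ []       ys p = sym (ℤP.+-identityˡ _)
  coverBy-++ (x ∷ xs) ys p = trans (cong (_+_ ⟦ does (p ∈ₛ? x) ⟧) (coverBy-++ xs ys p))
                                   (sym (ℤP.+-assoc ⟦ does (p ∈ₛ? x) ⟧ _ _))

  coverBy-concat : ∀ {m} (F : Fin m → List S) p →
    coverBy _∈ₛ?_ (concat (tabulate F)) p ≡ sumℤ (λ i → coverBy _∈ₛ?_ (F i) p)
  coverBy-concat {zero}  F p = refl
  coverBy-concat {suc m} F p =
    trans (coverBy-++ (F zero) _ p) (cong (_+_ (coverBy _∈ₛ?_ (F zero) p)) (coverBy-concat (F ∘ suc) p))

  coverBy-nonneg : ∀ ss p → 0ℤ ℤ.≤ coverBy _∈ₛ?_ ss p
  coverBy-nonneg []       p = ℤP.≤-refl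
  coverBy-nonneg (s ∷ ss) p = ℤP.+-mono-≤ (⟦⟧≥0 (does (p ∈ₛ? s))) (coverBy-nonneg ss p)

  coverBy-member : ∀ {ss p} → Any (p ∈ₛ_) ss → 1ℤ ℤ.≤ coverBy _∈ₛ?_ ss p
  coverBy-member {s ∷ ss} {p} (here p∈s)   =
    ℤP.+-mono-≤ (ℤP.≤-reflexive (cong ⟦_⟧ (sym (dec-true (p ∈ₛ? s) p∈s)))) (coverBy-nonneg ss p)
  coverBy-member {s ∷ ss} {p} (there p∈ss) = ℤP.+-mono-≤ (⟦⟧≥0 (does (p ∈ₛ? s))) (coverBy-member p∈ss)

  coverBy≤1⇒disjoint : ∀ ss → (∀ p → coverBy _∈ₛ?_ ss p ℤ.≤ 1ℤ) →
    AllPairs (λ s t → ∀ p → ¬ (p ∈ₛ s × p ∈ₛ t)) ss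
  coverBy≤1⇒disjoint []       _    = []
  coverBy≤1⇒disjoint (s ∷ ss) ≤1 = All.tabulate disjoint ∷ coverBy≤1⇒disjoint ss tail≤1
    where
    tail≤1 : ∀ p → coverBy _∈ₛ?_ ss p ℤ.≤ 1ℤ
    tail≤1 p = ℤP.≤-trans (≤⟦⟧+ (does (p ∈ₛ? s)) (coverBy _∈ₛ?_ ss p)) (≤1 p)
    disjoint : ∀ {t} → t ∈ ss → ∀ p → ¬ (p ∈ₛ s × p ∈ₛ t)
    disjoint t∈ss p (p∈s , p∈t) = 2≰1 (ℤP.≤-trans two≤ (≤1 p))
      where
      2≰1 : ¬ + 2 ℤ.≤ 1ℤ
      2≰1 (ℤ.+≤+ (s≤s ()))
      two≤ : + 2 ℤ.≤ coverBy _∈ₛ?_ (s ∷ ss) p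
      two≤ = subst (λ b → + 2 ℤ.≤ ⟦ b ⟧ + coverBy _∈ₛ?_ ss p) (sym (dec-true (p ∈ₛ? s) p∈s))
                   (ℤP.+-monoʳ-≤ 1ℤ (coverBy-member (lose t∈ss p∈t)))

toHSeg : ∀ {n} → Fin n → Interval n → HSeg n
toHSeg i (interval lo hi lo≤hi) = hseg i lo hi lo≤hi

toVSeg : ∀ {n} → Fin n → Interval n → VSeg n
toVSeg c (interval lo hi lo≤hi) = vseg c lo hi lo≤hi

countHℤ-own-row : ∀ {n} (r c : Fin n) Is → countHℤ (map (toHSeg r) Is) (r , c) ≡ coverCount Is (toℕ c)
countHℤ-own-row r c []                     = refl
countHℤ-own-row r c (interval _ _ _ ∷ Is) = cong₂ _+_ (⟦true∧⟧ (r Fin.≟ r) refl) (countHℤ-own-row r c Is)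

countHℤ-other-row : ∀ {n} (r i c : Fin n) Is → r ≢ i → countHℤ (map (toHSeg i) Is) (r , c) ≡ 0ℤ
countHℤ-other-row r i c []                     _   = refl
countHℤ-other-row r i c (interval _ _ _ ∷ Is) r≢i =
  cong₂ _+_ (⟦false∧⟧ (r Fin.≟ i) r≢i) (countHℤ-other-row r i c Is r≢i)

countVℤ-own-column : ∀ {n} (r c : Fin n) Is → countVℤ (map (toVSeg c) Is) (r , c) ≡ coverCount Is (toℕ r)
countVℤ-own-column r c []                     = refl
countVℤ-own-column r c (interval _ _ _ ∷ Is) = cong₂ _+_ (⟦true∧⟧ (c Fin.≟ c) refl) (countVℤ-own-column r c Is)

countVℤ-other-column : ∀ {n} (r c c′ : Fin n) Is → c ≢ c′ → countVℤ (map (toVSeg c′) Is) (r , c) ≡ 0ℤ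
countVℤ-other-column r c c′ []                     _   = refl
countVℤ-other-column r c c′ (interval _ _ _ ∷ Is) c≢c′ =
  cong₂ _+_ (⟦false∧⟧ (c Fin.≟ c′) c≢c′) (countVℤ-other-column r c c′ Is c≢c′)

length-concat : ∀ {m} {X : Set} (F : Fin m → List X) → + length (concat (tabulate F)) ≡ sumℤ (λ i → + length (F i))
length-concat {zero}  F = refl
length-concat {suc m} F = trans (cong +_ (length-++ (F zero))) (cong (_+_ (+ length (F zero))) (length-concat (F ∘ suc)))

module _ {n : ℕ} (B : Fin n → Bool) where
  open Runs n (pad B) (pad-beyond B) using (Maximal)

  run-maximal : ∀ {lo hi tlo thi : Fin n} (lo≤hi : lo Fin.≤ hi) → Maximal (interval lo hi lo≤hi) →
    tlo Fin.≤ lo → hi Fin.≤ thi → (∀ q → tlo Fin.≤ q → q Fin.≤ thi → B q ≡ true) →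
    ∀ q → tlo Fin.≤ q → q Fin.≤ thi → lo Fin.≤ q × q Fin.≤ hi
  run-maximal {lo} {hi} {tlo} {thi} lo≤hi maximal tlo≤lo hi≤thi within q tlo≤q q≤thi = after-lo , before-hi
    where
    open Runs.Maximal maximal
    true-between : ∀ p → p < n → toℕ tlo ≤ p → p ≤ toℕ thi → pad B p ≡ true
    true-between p p<n tlo≤p p≤thi = trans (pad-< B p p<n) (within (fromℕ< p<n)
      (subst (toℕ tlo ≤_) (sym (FinP.toℕ-fromℕ< p<n)) tlo≤p) (subst (_≤ toℕ thi) (sym (FinP.toℕ-fromℕ< p<n)) p≤thi))
    after-lo : lo Fin.≤ q
    after-lo with toℕ lo ℕ.≤? toℕ q | left-end
    ... | yes lo≤q | _ = lo≤q
    ... | no  lo≰q | inj₁ lo≡0 = ⊥-elim (lo≰q (subst (_≤ toℕ q) (sym lo≡0) z≤n))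
    ... | no  lo≰q | inj₂ (p , lo≡1+p , Bp≡false) = case trans (sym Bp≡false) (true-between p p<n tlo≤p p≤thi) of λ ()
      where
      q≤p = s≤s⁻¹ (subst (toℕ q <_) lo≡1+p (ℕP.≰⇒> lo≰q))
      p<n = ℕP.<-trans (subst (p <_) (sym lo≡1+p) ℕP.≤-refl) (FinP.toℕ<n lo)
      tlo≤p = ℕP.≤-trans tlo≤q q≤p
      p≤thi = ℕP.≤-trans (ℕP.n≤1+n p) (subst (_≤ toℕ thi) lo≡1+p (ℕP.≤-trans lo≤hi hi≤thi))
    before-hi : q Fin.≤ hi
    before-hi with toℕ q ℕ.≤? toℕ hi
    ... | yes q≤hi = q≤hi
    ... | no  q≰hi = case trans (sym right-end) (true-between (suc (toℕ hi)) hi+1<n tlo≤hi+1 hi+1≤thi) of λ ()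
      where
      hi<q = ℕP.≰⇒> q≰hi
      hi+1<n = ℕP.≤-<-trans hi<q (FinP.toℕ<n q)
      tlo≤hi+1 = ℕP.≤-trans tlo≤lo (ℕP.≤-trans lo≤hi (ℕP.n≤1+n (toℕ hi)))
      hi+1≤thi = ℕP.≤-trans hi<q q≤thi

-- From a cut to a separated family

blocked-turn : ∀ b {x y} → Bit x → Bit y → EntryCondition b (x - y) → ¬ EntryCondition b ((x - y) + 1ℤ) →
  x - y ≡ 0ℤ × (b ≡ S0 ⊎ b ≡ S-)
blocked-turn S0 (inj₁ refl) (inj₁ refl) _  _     = refl , inj₁ refl
blocked-turn S0 (inj₂ refl) (inj₂ refl) _  _     = refl , inj₁ refl
blocked-turn S0 (inj₁ refl) (inj₂ refl) () _
blocked-turn S0 (inj₂ refl) (inj₁ refl) () _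
blocked-turn S- (inj₁ refl) (inj₁ refl) _  _     = refl , inj₂ refl
blocked-turn S- (inj₂ refl) (inj₂ refl) _  _     = refl , inj₂ refl
blocked-turn S- (inj₁ refl) (inj₂ refl) _  ¬cond = ⊥-elim (¬cond (ℤ.+≤+ z≤n))
blocked-turn S- (inj₂ refl) (inj₁ refl) (ℤ.+≤+ ()) _
blocked-turn S+ (inj₁ refl) (inj₁ refl) _  ¬cond = ⊥-elim (¬cond (ℤ.+≤+ z≤n))
blocked-turn S+ (inj₂ refl) (inj₂ refl) _  ¬cond = ⊥-elim (¬cond (ℤ.+≤+ z≤n))
blocked-turn S+ (inj₂ refl) (inj₁ refl) _  ¬cond = ⊥-elim (¬cond (ℤ.+≤+ z≤n))
blocked-turn S+ (inj₁ refl) (inj₂ refl) () _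
blocked-turn SF _           _           _  ¬cond = ⊥-elim (¬cond tt)

blocked-unturn : ∀ b {x y} → Bit x → Bit y → EntryCondition b (x - y) → ¬ EntryCondition b ((x - y) + -1ℤ) →
  x - y ≡ 0ℤ × (b ≡ S0 ⊎ b ≡ S+)
blocked-unturn S0 (inj₁ refl) (inj₁ refl) _  _     = refl , inj₁ refl
blocked-unturn S0 (inj₂ refl) (inj₂ refl) _  _     = refl , inj₁ refl
blocked-unturn S0 (inj₁ refl) (inj₂ refl) () _
blocked-unturn S0 (inj₂ refl) (inj₁ refl) () _
blocked-unturn S+ (inj₁ refl) (inj₁ refl) _  _     = refl , inj₂ refl
blocked-unturn S+ (inj₂ refl) (inj₂ refl) _  _     = refl , inj₂ refl
blocked-unturn S+ (inj₂ refl) (inj₁ refl) _  ¬cond = ⊥-elim (¬cond (ℤ.+≤+ z≤n))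
blocked-unturn S+ (inj₁ refl) (inj₂ refl) () _
blocked-unturn S- (inj₁ refl) (inj₁ refl) _  ¬cond = ⊥-elim (¬cond ℤ.-≤+)
blocked-unturn S- (inj₂ refl) (inj₂ refl) _  ¬cond = ⊥-elim (¬cond ℤ.-≤+)
blocked-unturn S- (inj₁ refl) (inj₂ refl) _  ¬cond = ⊥-elim (¬cond ℤ.-≤+)
blocked-unturn S- (inj₂ refl) (inj₁ refl) (ℤ.+≤+ ()) _
blocked-unturn SF _           _           _  ¬cond = ⊥-elim (¬cond tt)

module CutProperties {n : ℕ} (P : Partition n) {k : ℕ} (flow : Network.Flow n P k)
                     (cut : Network.Residual.Cut n P (Network.Flow.h flow) (Network.Flow.v flow)) where
  open Network n P
  open Flow flow
  open Residual h v
  open import Data.List.Membership.DecPropositional _≟N_ using (_∈?_)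

  V : List Node
  V = proj₁ cut

  src∈V : src ∈ V
  src∈V = proj₁ (proj₂ cut)

  snk∉V : snk ∉ V
  snk∉V = proj₁ (proj₂ (proj₂ cut))

  closed : Closed V
  closed = proj₂ (proj₂ (proj₂ cut))

  inV : Node → Bool
  inV u = does (u ∈? V)

  inV-sound : ∀ {u} → inV u ≡ true → u ∈ V
  inV-sound {u} t = witness (u ∈? V) (subst T (sym t) tt)

  inV-complete : ∀ {u} → inV u ≡ false → u ∉ V
  inV-complete {u} f u∈V = case trans (sym f) (dec-true (u ∈? V) u∈V) of λ ()

  one-unless : ∀ {x} → Bit x → ¬ x ≡ 0ℤ → x ≡ 1ℤ
  one-unless (inj₁ x≡0) x≢0 = ⊥-elim (x≢0 x≡0)
  one-unless (inj₂ x≡1) _   = x≡1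

  zero-unless : ∀ {x} → Bit x → ¬ x ≡ 1ℤ → x ≡ 0ℤ
  zero-unless (inj₁ x≡0) _   = x≡0
  zero-unless (inj₂ x≡1) x≢1 = ⊥-elim (x≢1 x≡1)

  leaves : ∀ {a b} → inV a ≡ true → inV b ≡ false → ¬ Arc a b
  leaves a∈V b∉V x = inV-complete b∉V (closed (inV-sound a∈V) x)

  inV-leftOf : Fin n → ℕ → Bool
  inV-leftOf i zero    = true
  inV-leftOf i (suc g) = pad (λ j → inV (hN i j)) g

  inV-above : Fin n → ℕ → Bool
  inV-above c zero    = false
  inV-above c (suc g) = pad (λ r → inV (vN r c)) g

  row-fall : ∀ i g → g < n → inV-leftOf i g ≡ true → inV-leftOf i (suc g) ≡ false → h (toℕ i) g ≡ 1ℤ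
  row-fall i zero    0<n     _   out = one-unless (h-bit _ _) λ h≡0 →
    leaves (dec-true (src ∈? V) src∈V) (trans (sym (pad-< _ 0 0<n)) out) (source (FinP.toℕ-fromℕ< 0<n) h≡0)
  row-fall i (suc g) g+1<n inn out = subst (λ m → h (toℕ i) m ≡ 1ℤ) (FinP.toℕ-fromℕ< g+1<n) (one-unless (h-bit _ _) λ h≡0 →
    leaves (trans (sym (pad-< _ g g<n)) inn) (trans (sym (pad-< _ (suc g) g+1<n)) out) (right (consecutive g<n g+1<n) h≡0))
    where g<n = ℕP.<-trans (ℕP.n<1+n g) g+1<n

  row-rise : ∀ i g → g < n → inV-leftOf i g ≡ false → inV-leftOf i (suc g) ≡ true → h (toℕ i) g ≡ 0ℤ
  row-rise i (suc g) g+1<n out inn = subst (λ m → h (toℕ i) m ≡ 0ℤ) (FinP.toℕ-fromℕ< g+1<n) (zero-unless (h-bit _ _) λ h≡1 →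
    leaves (trans (sym (pad-< _ (suc g) g+1<n)) inn) (trans (sym (pad-< _ g g<n)) out) (left (consecutive g<n g+1<n) h≡1))
    where g<n = ℕP.<-trans (ℕP.n<1+n g) g+1<n

  column-fall : ∀ c g → g < suc n → inV-above c g ≡ true → inV-above c (suc g) ≡ false → v g (toℕ c) ≡ 1ℤ
  column-fall c (suc g) g<n+1 inn out with ℕP.m≤n⇒m<n∨m≡n (s≤s⁻¹ g<n+1)
  ... | inj₁ g+1<n = subst (λ m → v m (toℕ c) ≡ 1ℤ) (FinP.toℕ-fromℕ< g+1<n) (one-unless (v-bit _ _) λ v≡0 →
    leaves (trans (sym (pad-< _ g g<n)) inn) (trans (sym (pad-< _ (suc g) g+1<n)) out) (down (consecutive g<n g+1<n) v≡0))
    where g<n = s≤s⁻¹ g<n+1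
  ... | inj₂ g+1≡n = subst (λ m → v m (toℕ c) ≡ 1ℤ) (sym g+1≡n) (one-unless (v-bit _ _) λ v≡0 →
    snk∉V (closed (inV-sound (trans (sym (pad-< _ g g<n)) inn))
                  (sink (trans (cong suc (FinP.toℕ-fromℕ< g<n)) g+1≡n) v≡0)))
    where g<n = s≤s⁻¹ g<n+1

  column-rise : ∀ c g → g < suc n → inV-above c g ≡ false → inV-above c (suc g) ≡ true → v g (toℕ c) ≡ 0ℤ
  column-rise c zero    _     _   _   = v-top (toℕ c)
  column-rise c (suc g) g<n+1 out inn with ℕP.m≤n⇒m<n∨m≡n (s≤s⁻¹ g<n+1)
  ... | inj₁ g+1<n = subst (λ m → v m (toℕ c) ≡ 0ℤ) (FinP.toℕ-fromℕ< g+1<n) (zero-unless (v-bit _ _) λ v≡1 →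
    leaves (trans (sym (pad-< _ (suc g) g+1<n)) inn) (trans (sym (pad-< _ g g<n)) out) (up (consecutive g<n g+1<n) v≡1))
    where g<n = s≤s⁻¹ g<n+1
  ... | inj₂ g+1≡n = case trans (sym inn) (pad-beyond _ (suc g) (ℕP.≤-reflexive (sym g+1≡n))) of λ ()

  turn-blocked : ∀ i j → inV (hN i j) ≡ true → inV (vN i j) ≡ false →
    matrix h i j ≡ 0ℤ × (P (i , j) ≡ S0 ⊎ P (i , j) ≡ S-)
  turn-blocked i j inn out = blocked-turn (P (i , j)) (h-bit _ _) (h-bit _ _) (condition i j) (leaves inn out ∘ turn)

  unturn-blocked : ∀ i j → inV (hN i j) ≡ false → inV (vN i j) ≡ true →
    matrix h i j ≡ 0ℤ × (P (i , j) ≡ S0 ⊎ P (i , j) ≡ S+)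
  unturn-blocked i j out inn = blocked-unturn (P (i , j)) (h-bit _ _) (h-bit _ _) (condition i j) (leaves inn out ∘ unturn)

  -- The cut separates the two nodes of a cell only where no flow turns.
  cut-weight : ∀ i j → ⟦ inV (hN i j) ⟧ * matrix h i j ≡ ⟦ inV (vN i j) ⟧ * matrix h i j
  cut-weight i j with inV (hN i j) in hij | inV (vN i j) in vij
  ... | true  | true  = refl
  ... | false | false = refl
  ... | true  | false rewrite proj₁ (turn-blocked i j hij vij) = refl
  ... | false | true  rewrite proj₁ (unturn-blocked i j hij vij) = refl

  cut-cover-condition : ∀ i j → CoverCondition (P (i , j)) (⟦ not (inV (hN i j)) ⟧ℕ ℕ.+ ⟦ inV (vN i j) ⟧ℕ)
  cut-cover-condition i j with inV (hN i j) in hij | inV (vN i j) in vij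
  ... | true  | false with proj₂ (turn-blocked i j hij vij)
  ...   | inj₁ P≡S0 rewrite P≡S0 = tt
  ...   | inj₂ P≡S- rewrite P≡S- = z≤n
  cut-cover-condition i j | false | true with proj₂ (unturn-blocked i j hij vij)
  ...   | inj₁ P≡S0 rewrite P≡S0 = tt
  ...   | inj₂ P≡S+ rewrite P≡S+ = s≤s z≤n
  cut-cover-condition i j | true  | true  = covered-once (P (i , j))
  cut-cover-condition i j | false | false = covered-once (P (i , j))

module CutFamily {n : ℕ} (P : Partition n) {k : ℕ} (flow : Network.Flow n P k)
                 (cut : Network.Residual.Cut n P (Network.Flow.h flow) (Network.Flow.v flow)) where
  open Network n P
  open Flow flow
  open CutProperties P flow cut

  outsideH : Fin n → Fin n → Bool
  outsideH i j = not (inV (hN i j))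

  insideV : Fin n → Fin n → Bool
  insideV c r = inV (vN r c)

  module RowRuns    (i : Fin n) = Runs n (pad (outsideH i)) (pad-beyond (outsideH i))
  module ColumnRuns (c : Fin n) = Runs n (pad (insideV c)) (pad-beyond (insideV c))

  rowSegments : Fin n → List (HSeg n)
  rowSegments i = map (toHSeg i) (RowRuns.runs i)

  columnSegments : Fin n → List (VSeg n)
  columnSegments c = map (toVSeg c) (ColumnRuns.runs c)

  hor : List (HSeg n)
  hor = concat (tabulate rowSegments)

  ver : List (VSeg n)
  ver = concat (tabulate columnSegments)

  cutFamily : Family n
  cutFamily = family hor ver

  hor-cover : ∀ r c → countHℤ hor (r , c) ≡ ⟦ outsideH r c ⟧
  hor-cover r c = begin
    countHℤ hor (r , c)                           ≡⟨ coverBy-concat _∈H?_ rowSegments (r , c) ⟩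
    sumℤ (λ i → countHℤ (rowSegments i) (r , c))
      ≡⟨ sum-single _ r (λ i i≢r → countHℤ-other-row r i c (RowRuns.runs i) (i≢r ∘ sym)) ⟩
    countHℤ (rowSegments r) (r , c)               ≡⟨ countHℤ-own-row r c (RowRuns.runs r) ⟩
    coverCount (RowRuns.runs r) (toℕ c)           ≡⟨ RowRuns.coverCount-runs r (toℕ c) (FinP.toℕ<n c) ⟩
    ⟦ pad (outsideH r) (toℕ c) ⟧                  ≡⟨ cong ⟦_⟧ (pad-toℕ (outsideH r) c) ⟩
    ⟦ outsideH r c ⟧                              ∎
    where open ≡-Reasoning

  ver-cover : ∀ r c → countVℤ ver (r , c) ≡ ⟦ insideV c r ⟧
  ver-cover r c = begin
    countVℤ ver (r , c)                              ≡⟨ coverBy-concat _∈V?_ columnSegments (r , c) ⟩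
    sumℤ (λ c′ → countVℤ (columnSegments c′) (r , c))
      ≡⟨ sum-single _ c (λ c′ c′≢c → countVℤ-other-column r c c′ (ColumnRuns.runs c′) (c′≢c ∘ sym)) ⟩
    countVℤ (columnSegments c) (r , c)               ≡⟨ countVℤ-own-column r c (ColumnRuns.runs c) ⟩
    coverCount (ColumnRuns.runs c) (toℕ r)           ≡⟨ ColumnRuns.coverCount-runs c (toℕ r) (FinP.toℕ<n r) ⟩
    ⟦ pad (insideV c) (toℕ r) ⟧                      ≡⟨ cong ⟦_⟧ (pad-toℕ (insideV c) r) ⟩
    ⟦ insideV c r ⟧                                  ∎
    where open ≡-Reasoning

  countH-hor : ∀ r c → countH (r , c) hor ≡ ⟦ outsideH r c ⟧ℕ
  countH-hor r c = ℤP.+-injective (trans (countH≡countHℤ (r , c) hor) (trans (hor-cover r c) (sym (pos-⟦⟧ _))))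

  countV-ver : ∀ r c → countV (r , c) ver ≡ ⟦ insideV c r ⟧ℕ
  countV-ver r c = ℤP.+-injective (trans (countV≡countVℤ (r , c) ver) (trans (ver-cover r c) (sym (pos-⟦⟧ _))))

  RunSegmentH : HSeg n → Set
  RunSegmentH (hseg i lo hi lo≤hi) = RowRuns.Maximal i (interval lo hi lo≤hi)

  RunSegmentV : VSeg n → Set
  RunSegmentV (vseg c lo hi lo≤hi) = ColumnRuns.Maximal c (interval lo hi lo≤hi)

  hor-runs : All RunSegmentH hor
  hor-runs = AllP.concat⁺ (AllP.tabulate⁺ (λ i → AllP.map⁺ (RowRuns.runs-maximal i)))

  ver-runs : All RunSegmentV ver
  ver-runs = AllP.concat⁺ (AllP.tabulate⁺ (λ c → AllP.map⁺ (ColumnRuns.runs-maximal c)))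

  hor-maximal : ∀ {s} → s ∈ hor → MaximalH s (UnionH hor)
  hor-maximal {s@(hseg i lo hi lo≤hi)} s∈hor = (λ p p∈s → lose s∈hor p∈s) , within-s
    where
    within-s : ∀ t → (∀ p → p ∈H s → p ∈H t) → (∀ p → p ∈H t → UnionH hor p) → ∀ p → p ∈H t → p ∈H s
    within-s (hseg ti tlo thi _) s⊆t t⊆U (pr , pc) (pr≡ti , tlo≤pc , pc≤thi)
      with s⊆t (i , lo) (refl , ℕP.≤-refl , lo≤hi) | s⊆t (i , hi) (refl , lo≤hi , ℕP.≤-refl)
    ... | i≡ti , tlo≤lo , _ | _ , _ , hi≤thi =
      trans pr≡ti (sym i≡ti) ,
      run-maximal (outsideH i) lo≤hi (All.lookup hor-runs s∈hor) tlo≤lo hi≤thi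
        (λ q tlo≤q q≤thi → 1≤⟦⟧ (subst (1ℤ ℤ.≤_) (hor-cover i q) (coverBy-member _∈H?_ (t⊆U (i , q) (i≡ti , tlo≤q , q≤thi)))))
        pc tlo≤pc pc≤thi

  ver-maximal : ∀ {s} → s ∈ ver → MaximalV s (UnionV ver)
  ver-maximal {s@(vseg c lo hi lo≤hi)} s∈ver = (λ p p∈s → lose s∈ver p∈s) , within-s
    where
    within-s : ∀ t → (∀ p → p ∈V s → p ∈V t) → (∀ p → p ∈V t → UnionV ver p) → ∀ p → p ∈V t → p ∈V s
    within-s (vseg tc tlo thi _) s⊆t t⊆U (pr , pc) (pc≡tc , tlo≤pr , pr≤thi)
      with s⊆t (lo , c) (refl , ℕP.≤-refl , lo≤hi) | s⊆t (hi , c) (refl , lo≤hi , ℕP.≤-refl)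
    ... | c≡tc , tlo≤lo , _ | _ , _ , hi≤thi =
      trans pc≡tc (sym c≡tc) ,
      run-maximal (insideV c) lo≤hi (All.lookup ver-runs s∈ver) tlo≤lo hi≤thi
        (λ q tlo≤q q≤thi → 1≤⟦⟧ (subst (1ℤ ℤ.≤_) (ver-cover q c) (coverBy-member _∈V?_ (t⊆U (q , c) (c≡tc , tlo≤q , q≤thi)))))
        pr tlo≤pr pr≤thi

  separated : SeparatedFamily cutFamily
  separated =
    (coverBy≤1⇒disjoint _∈H?_ hor (λ (r , c) → subst (ℤ._≤ 1ℤ) (sym (hor-cover r c)) (⟦⟧≤1 _)) , All.tabulate hor-maximal) ,
    (coverBy≤1⇒disjoint _∈V?_ ver (λ (r , c) → subst (ℤ._≤ 1ℤ) (sym (ver-cover r c)) (⟦⟧≤1 _)) , All.tabulate ver-maximal)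

  admissible : AdmissibleCover P cutFamily
  admissible = coverCondition⇒admissible P {cutFamily} λ (i , j) →
    subst (CoverCondition (P (i , j))) (sym (cong₂ ℕ._+_ (countH-hor i j) (countV-ver i j))) (cut-cover-condition i j)

  rowCut columnCut : Fin n → ℤ
  rowCut i    = sumℤ (λ j → ⟦ inV (hN i j) ⟧ * matrix h i j)
  columnCut c = sumℤ (λ i → ⟦ inV (vN i c) ⟧ * matrix h i c)

  columnCuts≡rowCuts : sumℤ columnCut ≡ sumℤ rowCut
  columnCuts≡rowCuts = trans (sum-comm (λ c i → ⟦ inV (vN i c) ⟧ * matrix h i c))
                             (sum-cong (λ i → sum-cong (λ j → sym (cut-weight i j))))

  row-runs≡falls : ∀ i → + length (rowSegments i) ≡ sumUpTo n (falls (inV-leftOf i))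
  row-runs≡falls i = begin
    + length (rowSegments i)                 ≡⟨ cong +_ (length-map (toHSeg i) (RowRuns.runs i)) ⟩
    + length (RowRuns.runs i)                ≡⟨ RowRuns.length-runsUpTo i n ⟩
    sumUpTo n (λ g → ⟦ RowRuns.starts i g ⟧) ≡⟨ sumUpTo-cong n (λ g g<n → cong ⟦_⟧ (starts≡fall g g<n)) ⟩
    sumUpTo n (falls (inV-leftOf i))         ∎
    where
    open ≡-Reasoning
    pad-outside : ∀ g → g < n → pad (outsideH i) g ≡ not (pad (λ j → inV (hN i j)) g)
    pad-outside = pad-not (λ j → inV (hN i j))
    starts≡fall : ∀ g → g < n → RowRuns.starts i g ≡ inV-leftOf i g ∧ not (inV-leftOf i (suc g))
    starts≡fall zero    0<n   = pad-outside 0 0<n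
    starts≡fall (suc g) g+1<n = cong₂ _∧_ (trans (cong not (pad-outside g (ℕP.<-trans (ℕP.n<1+n g) g+1<n)))
                                                 (BoolP.not-involutive _))
                                          (pad-outside (suc g) g+1<n)

  row-weighted : ∀ i → sumUpTo n (λ g → ⟦ inV-leftOf i (suc g) ⟧ * (h (toℕ i) (suc g) - h (toℕ i) g)) ≡ - rowCut i
  row-weighted i = begin
    sumUpTo n F                   ≡⟨ sum≡sumUpTo n F ⟨
    sumℤ {n} (F ∘ toℕ)            ≡⟨ sum-cong (λ j → trans (cong (λ b → ⟦ b ⟧ * (h r (suc (toℕ j)) - h r (toℕ j))) (pad-toℕ _ j))
                                                       (flip ⟦ inV (hN i j) ⟧ (h r (toℕ j)) (h r (suc (toℕ j))))) ⟩
    sumℤ (λ j → - (⟦ inV (hN i j) ⟧ * matrix h i j)) ≡⟨ sum-neg (λ j → ⟦ inV (hN i j) ⟧ * matrix h i j) ⟩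
    - rowCut i                    ∎
    where
    open ≡-Reasoning
    r = toℕ i
    F : ℕ → ℤ
    F g = ⟦ inV-leftOf i (suc g) ⟧ * (h r (suc g) - h r g)
    flip : ∀ x a b → x * (b - a) ≡ - (x * (a - b))
    flip = solve-∀

  -- A row run outside the cut starts where the cut is left, i.e. where a unit of flow enters the row.
  row-length : ∀ i → + length (rowSegments i) ≡ h (toℕ i) 0 - rowCut i
  row-length i = begin
    + length (rowSegments i)           ≡⟨ row-runs≡falls i ⟩
    sumUpTo n (falls z)                ≡⟨ falls-by-parts z (h r) n (row-fall i) (row-rise i) ⟩
    (⟦ z 0 ⟧ * h r 0 - ⟦ z n ⟧ * h r n) + sumUpTo n (λ g → ⟦ z (suc g) ⟧ * (h r (suc g) - h r g))
                                       ≡⟨ cong₂ (λ e S → (1ℤ * h r 0 - ⟦ z n ⟧ * e) + S) (h-end r) (row-weighted i) ⟩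
    (1ℤ * h r 0 - ⟦ z n ⟧ * 0ℤ) + - rowCut i ≡⟨ ring (h r 0) ⟦ z n ⟧ (rowCut i) ⟩
    h r 0 - rowCut i                   ∎
    where
    open ≡-Reasoning
    r = toℕ i
    z = inV-leftOf i
    ring : ∀ a zn S → (1ℤ * a - zn * 0ℤ) + - S ≡ a - S
    ring = solve-∀

  column-runs≡falls : ∀ c → + length (columnSegments c) ≡ sumUpTo (suc n) (falls (inV-above c))
  column-runs≡falls c = begin
    + length (columnSegments c)                       ≡⟨ cong +_ (length-map (toVSeg c) (ColumnRuns.runs c)) ⟩
    + length (ColumnRuns.runs c)                      ≡⟨ ColumnRuns.length-runsUpTo c n ⟩
    sumUpTo n (λ g → ⟦ ColumnRuns.starts c g ⟧)
      ≡⟨ trans (cong (_+_ (sumUpTo n (λ g → ⟦ ColumnRuns.starts c g ⟧)) ∘ ⟦_⟧) no-start-at-n) (ℤP.+-identityʳ _) ⟨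
    sumUpTo (suc n) (λ g → ⟦ ColumnRuns.starts c g ⟧) ≡⟨ sumUpTo-cong (suc n) (λ g _ → cong ⟦_⟧ (starts≡rise g)) ⟩
    sumUpTo (suc n) (rises y)                         ≡⟨ rises≡falls y (suc n) ⟩
    sumUpTo (suc n) (falls y) + (⟦ y (suc n) ⟧ - 0ℤ)  ≡⟨ cong (λ b → sumUpTo (suc n) (falls y) + (⟦ b ⟧ - 0ℤ)) y-end ⟩
    sumUpTo (suc n) (falls y) + 0ℤ                    ≡⟨ ℤP.+-identityʳ _ ⟩
    sumUpTo (suc n) (falls y)                         ∎
    where
    open ≡-Reasoning
    y = inV-above c
    y-end : y (suc n) ≡ false
    y-end = pad-beyond (insideV c) n ℕP.≤-refl
    no-start-at-n : ColumnRuns.starts c n ≡ false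
    no-start-at-n = trans (cong (not (ColumnRuns.previous c n) ∧_) y-end) (BoolP.∧-zeroʳ _)
    starts≡rise : ∀ g → ColumnRuns.starts c g ≡ not (y g) ∧ y (suc g)
    starts≡rise zero    = refl
    starts≡rise (suc g) = refl

  -- A column run inside the cut ends where the cut is left, i.e. where a unit of flow leaves the column.
  column-length : ∀ c → + length (columnSegments c) ≡ columnCut c
  column-length c = begin
    + length (columnSegments c)     ≡⟨ column-runs≡falls c ⟩
    sumUpTo (suc n) (falls y)       ≡⟨ falls-by-parts y (λ g → v g cc) (suc n) (column-fall c) (column-rise c) ⟩
    (0ℤ * v 0 cc - ⟦ y (suc n) ⟧ * v (suc n) cc) + (S + ⟦ y (suc n) ⟧ * (v (suc n) cc - v n cc))
                                    ≡⟨ cong (λ b → (0ℤ * v 0 cc - ⟦ b ⟧ * v (suc n) cc) + (S + ⟦ b ⟧ * (v (suc n) cc - v n cc)))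
                                            (pad-beyond (insideV c) n ℕP.≤-refl) ⟩
    (0ℤ * v 0 cc - 0ℤ * v (suc n) cc) + (S + 0ℤ * (v (suc n) cc - v n cc))
                                    ≡⟨ ring S (v 0 cc) (v (suc n) cc) (v n cc) ⟩
    S                               ≡⟨ sum≡sumUpTo n F ⟨
    sumℤ {n} (F ∘ toℕ)              ≡⟨ sum-cong (λ i → cong₂ _*_ (cong ⟦_⟧ (pad-toℕ (insideV c) i)) (sym (conservation i c))) ⟩
    columnCut c                     ∎
    where
    open ≡-Reasoning
    cc = toℕ c
    y = inV-above c
    F : ℕ → ℤ
    F g = ⟦ y (suc g) ⟧ * (v (suc g) cc - v g cc)
    S = sumUpTo n F
    ring : ∀ S a b d → (0ℤ * a - 0ℤ * b) + (S + 0ℤ * (b - d)) ≡ S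
    ring = solve-∀

  size-cutFamily : size cutFamily ≡ k
  size-cutFamily = ℤP.+-injective (begin
    + length hor + + length ver
      ≡⟨ cong₂ _+_ (length-concat rowSegments) (length-concat columnSegments) ⟩
    sumℤ (λ i → + length (rowSegments i)) + sumℤ (λ c → + length (columnSegments c))
      ≡⟨ cong₂ _+_ (sum-cong row-length) (sum-cong column-length) ⟩
    sumℤ (λ i → h (toℕ i) 0 - rowCut i) + sumℤ columnCut
      ≡⟨ cong₂ _+_ (sum-distrib-- (λ i → h (toℕ i) 0) rowCut) columnCuts≡rowCuts ⟩
    (sumℤ (λ (i : Fin n) → h (toℕ i) 0) - sumℤ rowCut) + sumℤ rowCut
      ≡⟨ cong (λ a → (a - sumℤ rowCut) + sumℤ rowCut) h-value ⟩
    (+ k - sumℤ rowCut) + sumℤ rowCut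
      ≡⟨ ring (+ k) (sumℤ rowCut) ⟩
    + k ∎)
    where
    open ≡-Reasoning
    ring : ∀ K W → (K - W) + W ≡ K
    ring = solve-∀

corollary6p4 : (n : ℕ) → 1 ≤ n → (P : Partition n) →
    (∃ λ (A : Matrix n) → IsASM A × Respects P A) ⇔
    (∀ (I : Family n) → SeparatedFamily I → AdmissibleCover P I → n ≤ size I)
corollary6p4 n _ P = mk⇔ necessity sufficiency
  where
  necessity : (∃ λ (A : Matrix n) → IsASM A × Respects P A) →
              (∀ (I : Family n) → SeparatedFamily I → AdmissibleCover P I → n ≤ size I)
  necessity (A , asm , respects) I _ admissible = asm⇒cover-bound A asm P respects I admissible

  sufficiency : (∀ (I : Family n) → SeparatedFamily I → AdmissibleCover P I → n ≤ size I) →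
                (∃ λ (A : Matrix n) → IsASM A × Respects P A)
  sufficiency bound with Network.flow-or-cut n P n ℕP.≤-refl
  ... | inj₁ flow                   = flow⇒asm P flow
  ... | inj₂ (k , k<n , flow , cut) =
    ⊥-elim (ℕP.<⇒≱ k<n (subst (n ≤_) size-cutFamily (bound cutFamily separated admissible)))
    where open CutFamily P flow cut
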